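{- No face of $ASM_n$ (for any $n$) has the combinatorial type of the Birkhoff polytope $B_3$, i.e. no face of $ASM_n$ has face lattice isomorphic to that of $B_3$.
   Context: An $n\times n$ alternating sign matrix (ASM) is a matrix with entries in $\{0,1,-1\}$ whose rows and columns each sum to $1$ and in which the nonzero entries of each row and of each column alternate in sign. $ASM_n\subset\mathbb{R}^{n\times n}$ is the convex hull of all $n\times n$ ASMs. $B_3$ is the convex hull of the six $3\times 3$ permutation matrices (a 4-dimensional polytope with 6 vertices and 9 tetrahedral facets). -}

module Defs where

open import Data.Nat using (ℕ; zero; suc)
open import Data.Fin using (Fin; zero; suc; _<_)
open import Data.Integer as ℤ using (ℤ; 0ℤ; 1ℤ; -1ℤ)
open import Data.Rational as ℚ using (ℚ; 0ℚ; _/_)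
open import Data.Product using (Σ; _×_; _,_; proj₁)
open import Data.Sum using (_⊎_)
open import Function using (_∘_)
open import Function.Bundles using (_⇔_)
open import Relation.Binary.PropositionalEquality using (_≡_; _≢_)

Mat : ℕ → Set
Mat n = Fin n → Fin n → ℤ

sumFin : ∀ {n} {A : Set} → (A → A → A) → A → (Fin n → A) → A
sumFin {zero}  _+_ e f = e
sumFin {suc n} _+_ e f = f zero + sumFin _+_ e (f ∘ suc)

Σℤ : ∀ {n} → (Fin n → ℤ) → ℤ
Σℤ = sumFin ℤ._+_ 0ℤ

Σℚ : ∀ {n} → (Fin n → ℚ) → ℚ
Σℚ = sumFin ℚ._+_ 0ℚ

transpose : ∀ {n} → Mat n → Mat n
transpose A i j = A j i

Alternating : ∀ {n} → (Fin n → ℤ) → Set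
Alternating {n} r =
  (j k : Fin n) → j < k → r j ≢ 0ℤ → r k ≢ 0ℤ →
  ((l : Fin n) → j < l → l < k → r l ≡ 0ℤ) →
  r j ≡ ℤ.- r k

record IsASM {n} (A : Mat n) : Set where
  field
    entries  : (i j : Fin n) → A i j ≡ 0ℤ ⊎ (A i j ≡ 1ℤ ⊎ A i j ≡ -1ℤ)
    rowSum   : (i : Fin n) → Σℤ (A i) ≡ 1ℤ
    colSum   : (j : Fin n) → Σℤ (λ i → A i j) ≡ 1ℤ
    rowAlt   : (i : Fin n) → Alternating (A i)
    colAlt   : (j : Fin n) → Alternating (λ i → A i j)

record IsPerm {n} (A : Mat n) : Set where
  field
    entries  : (i j : Fin n) → A i j ≡ 0ℤ ⊎ A i j ≡ 1ℤ
    rowSum   : (i : Fin n) → Σℤ (A i) ≡ 1ℤ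
    colSum   : (j : Fin n) → Σℤ (λ i → A i j) ≡ 1ℤ

dot : ∀ {n} → (Fin n → Fin n → ℚ) → Mat n → ℚ
dot c A = Σℚ (λ i → Σℚ (λ j → c i j ℚ.* (A i j / 1)))

-- A face of the polytope conv{A : V A}, given by a valid linear inequality
-- ⟨c,x⟩ ≤ b (c = 0, b = 0 gives the whole polytope; c = 0, b = 1 the empty face).
record Face {n} (V : Mat n → Set) : Set where
  field
    c     : Fin n → Fin n → ℚ
    b     : ℚ
    valid : (A : Mat n) → V A → dot c A ℚ.≤ b

-- the vertices lying on a face (a face is the convex hull of these)
vert : ∀ {n} {V : Mat n → Set} → Face V → Mat n → Set
vert {V = V} F A = V A × dot (Face.c F) A ≡ Face.b F

_⊑_ : ∀ {n} {V : Mat n → Set} → Face V → Face V → Set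
F ⊑ G = ∀ A → vert F A → vert G A

FacesBelow : ∀ {n} → Face (IsASM {n}) → Set
FacesBelow {n} F = Σ (Face (IsASM {n})) (λ G → G ⊑ F)

-- B_3 = conv of 3×3 permutation matrices
B3 : Mat 3 → Set
B3 = IsPerm {3}

-- the face lattice of F is isomorphic to the face lattice of B_3:
-- an order-embedding onto (faces identified when they coincide as sets)
FaceLatticeIsoB3 : ∀ {n} → Face (IsASM {n}) → Set
FaceLatticeIsoB3 F =
  Σ (FacesBelow F → Face B3) λ φ →
    ((G H : FacesBelow F) → (proj₁ G ⊑ proj₁ H) ⇔ (φ G ⊑ φ H)) ×
    ((K : Face B3) → Σ (FacesBelow F) λ G → (φ G ⊑ K) × (K ⊑ φ G))

module Submission where

-- A matrix is an ASM iff all its partial row and column sums Σ_{j ≥ k} X a j, Σ_{i ≥ k} X i a are 0 or 1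
-- and the full sums are 1; equivalently, its corner-sum (height) function h(a, b) = Σ_{i ≥ a, j ≥ b} X i j
-- has boundary steps 1 and inner steps 0 or 1. Pointwise min and max of such functions are again height
-- functions, and ASM_n is the polytope cut out by 0 ≤ partial sum ≤ 1.
--
-- Suppose a face F of ASM_n has the face lattice of B₃. Its vertices are six ASMs X_σ (σ ∈ S₃); any two of
-- them span an edge, because B₃ is 2-neighbourly, and a face of F containing the three even vertices
-- contains the three odd ones and conversely, because the even and the odd permutation matrices have the
-- same sum. On the edge X_σ X_τ the ASMs with heights min(h_σ, h_τ) and max(h_σ, h_τ) add up to X_σ + X_τ,
-- so the former is a vertex of the edge: the six heights form a chain; a shifted version of this shows
-- that any two of them differ by at most 1 at every point. Let m be a vertex of parity opposite to the
-- lowest vertex and different from the highest one, and let i and j be its neighbours in the chain among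
-- T = {highest vertex} ∪ {vertices of the lowest one's parity}. The smallest face containing T contains m
-- by parity, i.e. m satisfies every partial-sum equation common to T. This makes every partial sum of
-- X_i + X_j − X_m a 0 or 1, so it is a vertex X_r of F; comparing h_r = h_i + h_j − h_m with h_m in the
-- chain then forces m = j or m = i, contradicting m ∉ T.

open import Defs
open import Algebra.Bundles using (CommutativeMonoid)
import Algebra.Properties.CommutativeSemigroup as CommSemigroupProps
open import Data.Bool using (Bool; true; false; not)
import Data.Bool.Properties as BoolP
open import Data.Empty using (⊥; ⊥-elim)
open import Data.Fin as Fin using (Fin; zero; suc; toℕ; fromℕ<)
import Data.Fin.Properties as FinP
open import Data.Integer as ℤ
  using (ℤ; -[1+_]; 0ℤ; 1ℤ; -1ℤ; _+_; _-_; -_; _*_; _≤_; _⊓_; _⊔_; pred)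
  renaming (suc to sucℤ)
import Data.Integer.Properties as ℤP
open import Algebra.Properties.CommutativeSemigroup ℤP.+-commutativeSemigroup
  using () renaming (interchange to +-interchange)
open import Data.Integer.Tactic.RingSolver using (solve-∀)
open import Data.List using (List; []; _∷_; map; allFin; cartesianProduct; filter)
import Data.List.Extrema
open import Data.List.Membership.Propositional using (_∈_; _∉_)
open import Data.List.Membership.Propositional.Properties
  using (∈-allFin; ∈-cartesianProduct⁺; ∈-map⁺; ∈-map⁻; ∈-filter⁺; ∈-filter⁻)
open import Data.List.Relation.Unary.All as All using (All; []; all?)
import Data.List.Relation.Unary.All.Properties as AllP
open import Data.List.Relation.Unary.Any using (here; there)
open import Data.Nat as ℕ using (ℕ; zero; suc; z≤n; s≤s)
open import Data.Nat.DivMod using (_mod_)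
import Data.Nat.Coprimality as Coprime
import Data.Nat.Properties as ℕP
open import Data.Product using (Σ; _×_; _,_; proj₁; proj₂)
import Data.Product.Properties as ProductP
open import Data.Rational as ℚ using (ℚ; 0ℚ; _/_; mkℚ)
import Data.Rational.Properties as ℚP
open import Data.Sum as Sum using (_⊎_; inj₁; inj₂; [_,_]′)
open import Function using (_∘_)
open import Function.Bundles using (Equivalence)
open import Level using (0ℓ)
open import Relation.Binary.Bundles using (TotalOrder)
open import Relation.Binary.Definitions using (tri<; tri≈; tri>)
open import Relation.Binary.PropositionalEquality
open import Relation.Binary.Structures using (IsTotalOrder; IsDecTotalOrder)
open import Relation.Nullary using (¬_; Dec; yes; no)
open import Relation.Nullary.Decidable using (from-yes; map′; _×-dec_; _⊎-dec_; _→-dec_)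

toℚ : ℤ → ℚ
toℚ z = z / 1

toℚ≡mkℚ : ∀ z → toℚ z ≡ mkℚ z 0 (Coprime.sym (Coprime.1-coprimeTo _))
toℚ≡mkℚ (ℤ.+ n)  = ℚP.normalize-coprime (Coprime.sym (Coprime.1-coprimeTo n))
toℚ≡mkℚ -[1+ n ] = cong ℚ.-_ (ℚP.normalize-coprime (Coprime.sym (Coprime.1-coprimeTo (suc n))))

toℚ-+ : ∀ a b → toℚ (a + b) ≡ toℚ a ℚ.+ toℚ b
toℚ-+ a b rewrite toℚ≡mkℚ a | toℚ≡mkℚ b =
  cong (_/ 1) (cong₂ _+_ (sym (ℤP.*-identityʳ a)) (sym (ℤP.*-identityʳ b)))

toℚ-* : ∀ a b → toℚ (a * b) ≡ toℚ a ℚ.* toℚ b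
toℚ-* a b rewrite toℚ≡mkℚ a | toℚ≡mkℚ b = refl

toℚ-cancel-≤ : ∀ {a b} → toℚ a ℚ.≤ toℚ b → a ≤ b
toℚ-cancel-≤ {a} {b} a≤b rewrite toℚ≡mkℚ a | toℚ≡mkℚ b with a≤b
... | ℚ.*≤* a*1≤b*1 = subst₂ _≤_ (ℤP.*-identityʳ a) (ℤP.*-identityʳ b) a*1≤b*1

toℚ-mono-≤ : ∀ {a b} → a ≤ b → toℚ a ℚ.≤ toℚ b
toℚ-mono-≤ {a} {b} a≤b rewrite toℚ≡mkℚ a | toℚ≡mkℚ b =
  ℚ.*≤* (subst₂ _≤_ (sym (ℤP.*-identityʳ a)) (sym (ℤP.*-identityʳ b)) a≤b)

toℚ-injective : ∀ {a b} → toℚ a ≡ toℚ b → a ≡ b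
toℚ-injective e = ℤP.≤-antisym (toℚ-cancel-≤ (ℚP.≤-reflexive e)) (toℚ-cancel-≤ (ℚP.≤-reflexive (sym e)))

module FinSum {ℓ} (M : CommutativeMonoid 0ℓ ℓ) where
  open CommutativeMonoid M
    using (Carrier; _≈_; _∙_; ε; ∙-cong; ∙-congˡ; identityˡ; commutativeSemigroup)
    renaming (refl to ≈-refl; sym to ≈-sym; trans to ≈-trans)
  open CommSemigroupProps commutativeSemigroup using (interchange)

  ∑ : ∀ {n} → (Fin n → Carrier) → Carrier
  ∑ = sumFin _∙_ ε

  ∑-cong : ∀ {n} {f g : Fin n → Carrier} → (∀ i → f i ≈ g i) → ∑ f ≈ ∑ g
  ∑-cong {zero}  f≈g = ≈-refl
  ∑-cong {suc n} f≈g = ∙-cong (f≈g zero) (∑-cong (f≈g ∘ suc))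

  ∑-distrib-∙ : ∀ {n} (f g : Fin n → Carrier) → ∑ (λ i → f i ∙ g i) ≈ ∑ f ∙ ∑ g
  ∑-distrib-∙ {zero}  f g = ≈-sym (identityˡ ε)
  ∑-distrib-∙ {suc n} f g =
    ≈-trans (∙-congˡ (∑-distrib-∙ (f ∘ suc) (g ∘ suc))) (interchange (f zero) (g zero) _ _)

  ∑-ε : ∀ {n} {f : Fin n → Carrier} → (∀ i → f i ≈ ε) → ∑ f ≈ ε
  ∑-ε {zero}  f≈ε = ≈-refl
  ∑-ε {suc n} f≈ε = ≈-trans (∙-cong (f≈ε zero) (∑-ε (f≈ε ∘ suc))) (identityˡ ε)

module ℤSum = FinSum ℤP.+-0-commutativeMonoid
module ℚSum = FinSum ℚP.+-0-commutativeMonoid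

module ListOrder {A : Set} {_≤_ : A → A → Set} (isDecTotalOrder : IsDecTotalOrder _≡_ _≤_) where
  open IsDecTotalOrder isDecTotalOrder using (total; _≤?_; isTotalOrder)
  private
    ≤-totalOrder : TotalOrder 0ℓ 0ℓ 0ℓ
    ≤-totalOrder = record { isTotalOrder = isTotalOrder }

    module Ext = Data.List.Extrema ≤-totalOrder

  least : ∀ {xs} x → (∀ y → y ∈ xs) → Σ A λ μ → ∀ y → μ ≤ y
  least {xs} x every = Ext.min x xs , λ y → All.lookup (Ext.min≤xs x xs) (every y)

  greatest : ∀ {xs} x → (∀ y → y ∈ xs) → Σ A λ μ → ∀ y → y ≤ μ
  greatest {xs} x every = Ext.max x xs , λ y → All.lookup (Ext.xs≤max x xs) (every y)

  neighbours : ∀ m T {lo hi} → lo ∈ T → lo ≤ m → hi ∈ T → m ≤ hi →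
    Σ A λ i → Σ A λ j → (i ∈ T × i ≤ m) × (j ∈ T × m ≤ j) × (∀ {t} → t ∈ T → t ≤ i ⊎ j ≤ t)
  neighbours m T {lo} {hi} lo∈T lo≤m hi∈T m≤hi =
    i , j ,
    Ext.argmax-all (λ x → x) {P = λ t → t ∈ T × t ≤ m} (lo∈T , lo≤m) (All.tabulate (∈-filter⁻ (_≤? m))) ,
    Ext.argmin-all (λ x → x) {P = λ t → t ∈ T × m ≤ t} (hi∈T , m≤hi) (All.tabulate (∈-filter⁻ (m ≤?_))) ,
    λ t∈T → Sum.map
      (λ t≤m → All.lookup (Ext.xs≤max lo below) (∈-filter⁺ (_≤? m) t∈T t≤m))
      (λ m≤t → All.lookup (Ext.min≤xs hi above) (∈-filter⁺ (m ≤?_) t∈T m≤t))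
      (total _ m)
    where
    below = filter (_≤? m) T
    above = filter (m ≤?_) T
    i = Ext.max lo below
    j = Ext.min hi above

¬¬-∀-Fin : ∀ {n} {P : Fin n → Set} → (∀ i → ¬ ¬ P i) → ¬ ¬ (∀ i → P i)
¬¬-∀-Fin {zero}  ¬¬P ¬∀P = ¬∀P λ ()
¬¬-∀-Fin {suc n} ¬¬P ¬∀P = ¬¬P zero λ P₀ → ¬¬-∀-Fin (¬¬P ∘ suc) λ Pₛ → ¬∀P λ { zero → P₀ ; (suc i) → Pₛ i }

Σℤ-*ˡ : ∀ {n} c (f : Fin n → ℤ) → Σℤ (λ i → c * f i) ≡ c * Σℤ f
Σℤ-*ˡ {zero}  c f = sym (ℤP.*-zeroʳ c)
Σℤ-*ˡ {suc n} c f =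
  trans (cong (λ s → c * f zero + s) (Σℤ-*ˡ c (f ∘ suc))) (sym (ℤP.*-distribˡ-+ c (f zero) _))

Σℤ-neg : ∀ {n} (f : Fin n → ℤ) → Σℤ (λ i → - f i) ≡ - Σℤ f
Σℤ-neg {zero}  f = refl
Σℤ-neg {suc n} f =
  trans (cong (λ s → - f zero + s) (Σℤ-neg (f ∘ suc))) (sym (ℤP.neg-distrib-+ (f zero) _))

Σℤ-toℚ : ∀ {n} (f : Fin n → ℤ) → Σℚ (λ i → toℚ (f i)) ≡ toℚ (Σℤ f)
Σℤ-toℚ {zero}  f = refl
Σℤ-toℚ {suc n} f = trans (cong (toℚ (f zero) ℚ.+_) (Σℤ-toℚ (f ∘ suc))) (sym (toℚ-+ (f zero) _))

infix 4 _≐_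
infixl 6 _+ᴹ_ _-ᴹ_

_≐_ : ∀ {n} → Mat n → Mat n → Set
A ≐ B = ∀ i j → A i j ≡ B i j

≐-sym : ∀ {n} {A B : Mat n} → A ≐ B → B ≐ A
≐-sym A≐B i j = sym (A≐B i j)

_+ᴹ_ _-ᴹ_ : ∀ {n} → Mat n → Mat n → Mat n
(A +ᴹ B) i j = A i j + B i j
(A -ᴹ B) i j = A i j - B i j

⟨_,_⟩ℤ : ∀ {n} → Mat n → Mat n → ℤ
⟨ w , A ⟩ℤ = Σℤ λ i → Σℤ λ j → w i j * A i j

Coeffs : ℕ → Set
Coeffs n = Fin n → Fin n → ℚ

dot-cong : ∀ {n} (c : Coeffs n) {A B : Mat n} → A ≐ B → dot c A ≡ dot c B
dot-cong {n} c A≐B = ℚSum.∑-cong {n} λ i → ℚSum.∑-cong {n} λ j → cong (λ z → c i j ℚ.* toℚ z) (A≐B i j)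

dot-+ᴹ : ∀ {n} (c : Coeffs n) (A B : Mat n) → dot c (A +ᴹ B) ≡ dot c A ℚ.+ dot c B
dot-+ᴹ {n} c A B = trans
  (ℚSum.∑-cong {n} λ i → trans
    (ℚSum.∑-cong {n} λ j → trans (cong (c i j ℚ.*_) (toℚ-+ (A i j) (B i j))) (ℚP.*-distribˡ-+ (c i j) _ _))
    (ℚSum.∑-distrib-∙ {n} _ _))
  (ℚSum.∑-distrib-∙ {n} _ _)

dot-+ᶜ : ∀ {n} (c d : Coeffs n) (A : Mat n) →
  dot (λ i j → c i j ℚ.+ d i j) A ≡ dot c A ℚ.+ dot d A
dot-+ᶜ {n} c d A = trans
  (ℚSum.∑-cong {n} λ i → trans
    (ℚSum.∑-cong {n} λ j → ℚP.*-distribʳ-+ (toℚ (A i j)) (c i j) (d i j))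
    (ℚSum.∑-distrib-∙ {n} _ _))
  (ℚSum.∑-distrib-∙ {n} _ _)

dot-zeroᶜ : ∀ {n} (A : Mat n) → dot (λ _ _ → 0ℚ) A ≡ 0ℚ
dot-zeroᶜ {n} A = ℚSum.∑-ε {n} λ i → ℚSum.∑-ε {n} λ j → ℚP.*-zeroˡ (toℚ (A i j))

dot-zeroᴹ : ∀ {n} (c : Coeffs n) → dot c (λ _ _ → 0ℤ) ≡ 0ℚ
dot-zeroᴹ {n} c = ℚSum.∑-ε {n} λ i → ℚSum.∑-ε {n} λ j → ℚP.*-zeroʳ (c i j)

dot-toℚ : ∀ {n} (w A : Mat n) → dot (λ i j → toℚ (w i j)) A ≡ toℚ ⟨ w , A ⟩ℤ
dot-toℚ {n} w A = trans
  (ℚSum.∑-cong {n} λ i → trans (ℚSum.∑-cong {n} λ j → sym (toℚ-* (w i j) (A i j))) (Σℤ-toℚ {n} _))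
  (Σℤ-toℚ {n} _)

∑ᴹ : ∀ {k n} → (Fin k → Mat n) → Mat n
∑ᴹ A i j = Σℤ λ c → A c i j

dot-∑ᴹ : ∀ {k n} (c : Coeffs n) (A : Fin k → Mat n) → dot c (∑ᴹ A) ≡ Σℚ (λ l → dot c (A l))
dot-∑ᴹ {zero}  c A = dot-zeroᴹ c
dot-∑ᴹ {suc k} c A = trans (dot-+ᴹ c (A zero) (∑ᴹ (A ∘ suc))) (cong (dot c (A zero) ℚ.+_) (dot-∑ᴹ c (A ∘ suc)))

+-tightˡ : ∀ {x y a b : ℚ} → x ℚ.≤ a → y ℚ.≤ b → x ℚ.+ y ≡ a ℚ.+ b → x ≡ a
+-tightˡ {x} {y} {a} {b} x≤a y≤b x+y≡a+b with a ℚP.≤? x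
... | yes a≤x = ℚP.≤-antisym x≤a a≤x
... | no  a≰x = ⊥-elim (ℚP.<-irrefl x+y≡a+b (ℚP.+-mono-<-≤ (ℚP.≰⇒> a≰x) y≤b))

+-tightʳ : ∀ {x y a b : ℚ} → x ℚ.≤ a → y ℚ.≤ b → x ℚ.+ y ≡ a ℚ.+ b → y ≡ b
+-tightʳ {x} {y} {a} {b} x≤a y≤b x+y≡a+b =
  +-tightˡ y≤b x≤a (trans (ℚP.+-comm y x) (trans x+y≡a+b (ℚP.+-comm a b)))

Σℚ-mono-≤ : ∀ {k} {f g : Fin k → ℚ} → (∀ c → f c ℚ.≤ g c) → Σℚ f ℚ.≤ Σℚ g
Σℚ-mono-≤ {zero}  f≤g = ℚP.≤-refl
Σℚ-mono-≤ {suc k} f≤g = ℚP.+-mono-≤ (f≤g zero) (Σℚ-mono-≤ {k} (f≤g ∘ suc))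

Σℚ-tight : ∀ {k} {x : Fin k → ℚ} {b : ℚ} → (∀ c → x c ℚ.≤ b) → Σℚ x ≡ Σℚ {k} (λ _ → b) → ∀ c → x c ≡ b
Σℚ-tight {suc k} x≤b ∑x≡∑b zero    = +-tightˡ (x≤b zero) (Σℚ-mono-≤ {k} (x≤b ∘ suc)) ∑x≡∑b
Σℚ-tight {suc k} x≤b ∑x≡∑b (suc c) =
  Σℚ-tight {k} (x≤b ∘ suc) (+-tightʳ (x≤b zero) (Σℚ-mono-≤ {k} (x≤b ∘ suc)) ∑x≡∑b) c

module _ {n} {V : Mat n → Set} where

  wholeFace : Face V
  wholeFace = record { c = λ _ _ → 0ℚ ; b = 0ℚ ; valid = λ A _ → ℚP.≤-reflexive (dot-zeroᶜ A) }

  emptyFace : Face V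
  emptyFace = record
    { c = λ _ _ → 0ℚ ; b = toℚ 1ℤ
    ; valid = λ A _ → ℚP.≤-trans (ℚP.≤-reflexive (dot-zeroᶜ A)) (toℚ-mono-≤ {0ℤ} {1ℤ} (ℤ.+≤+ ℕ.z≤n)) }

  vert-wholeFace : ∀ {A} → V A → vert wholeFace A
  vert-wholeFace {A} vA = vA , dot-zeroᶜ A

  ¬vert-emptyFace : ∀ {A} → ¬ vert emptyFace A
  ¬vert-emptyFace {A} (_ , 0≡1) with toℚ-injective {0ℤ} {1ℤ} (trans (sym (dot-zeroᶜ A)) 0≡1)
  ... | ()

  infixr 7 _∩ᶠ_

  _∩ᶠ_ : Face V → Face V → Face V
  G ∩ᶠ H = record
    { c = λ i j → Face.c G i j ℚ.+ Face.c H i j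
    ; b = Face.b G ℚ.+ Face.b H
    ; valid = λ A vA → ℚP.≤-trans (ℚP.≤-reflexive (dot-+ᶜ (Face.c G) (Face.c H) A))
                                  (ℚP.+-mono-≤ (Face.valid G A vA) (Face.valid H A vA)) }

  vert-∩⁺ : ∀ G H {A} → vert G A → vert H A → vert (G ∩ᶠ H) A
  vert-∩⁺ G H {A} (vA , onG) (_ , onH) = vA , trans (dot-+ᶜ (Face.c G) (Face.c H) A) (cong₂ ℚ._+_ onG onH)

  vert-∩⁻ : ∀ G H {A} → vert (G ∩ᶠ H) A → vert G A × vert H A
  vert-∩⁻ G H {A} (vA , onG∩H) =
    (vA , +-tightˡ boundG boundH sum) , (vA , +-tightʳ boundG boundH sum)
    where
    boundG = Face.valid G A vA
    boundH = Face.valid H A vA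
    sum = trans (sym (dot-+ᶜ (Face.c G) (Face.c H) A)) onG∩H

  ⋂ᶠ : ∀ {k} → (Fin k → Face V) → Face V
  ⋂ᶠ {zero}  G = wholeFace
  ⋂ᶠ {suc k} G = G zero ∩ᶠ ⋂ᶠ (G ∘ suc)

  vert-⋂⁺ : ∀ {k} (G : Fin k → Face V) {A} → V A → (∀ l → vert (G l) A) → vert (⋂ᶠ G) A
  vert-⋂⁺ {zero}  G vA onG = vert-wholeFace vA
  vert-⋂⁺ {suc k} G vA onG = vert-∩⁺ (G zero) (⋂ᶠ (G ∘ suc)) (onG zero) (vert-⋂⁺ (G ∘ suc) vA (onG ∘ suc))

  vert-⋂⁻ : ∀ {k} (G : Fin k → Face V) {A} → vert (⋂ᶠ G) A → ∀ l → vert (G l) A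
  vert-⋂⁻ {suc k} G on⋂ zero    = proj₁ (vert-∩⁻ (G zero) (⋂ᶠ (G ∘ suc)) on⋂)
  vert-⋂⁻ {suc k} G on⋂ (suc l) = vert-⋂⁻ (G ∘ suc) (proj₂ (vert-∩⁻ (G zero) (⋂ᶠ (G ∘ suc)) on⋂)) l

  vert-resp-≐ : ∀ (G : Face V) {A B} → V B → A ≐ B → vert G A → vert G B
  vert-resp-≐ G vB A≐B (_ , onG) = vB , trans (sym (dot-cong (Face.c G) A≐B)) onG

  face-balanced : ∀ (G : Face V) {k} (A B : Fin k → Mat n) → ∑ᴹ A ≐ ∑ᴹ B →
    (∀ l → V (B l)) → (∀ l → vert G (A l)) → ∀ l → vert G (B l)
  face-balanced G {k} A B ∑A≐∑B vB onA l = vB l , Σℚ-tight (λ l → Face.valid G (B l) (vB l)) sums l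
    where
    open ≡-Reasoning
    sums : Σℚ {k} (λ l → dot (Face.c G) (B l)) ≡ Σℚ {k} (λ _ → Face.b G)
    sums = begin
      Σℚ (λ l → dot (Face.c G) (B l)) ≡⟨ sym (dot-∑ᴹ (Face.c G) B) ⟩
      dot (Face.c G) (∑ᴹ B)           ≡⟨ sym (dot-cong (Face.c G) ∑A≐∑B) ⟩
      dot (Face.c G) (∑ᴹ A)           ≡⟨ dot-∑ᴹ (Face.c G) A ⟩
      Σℚ (λ l → dot (Face.c G) (A l)) ≡⟨ ℚSum.∑-cong {k} (proj₂ ∘ onA) ⟩
      Σℚ {k} (λ _ → Face.b G)         ∎

  face-extreme : ∀ (G : Face V) {X Z Y Y′} → V Y → V Y′ → Y +ᴹ Y′ ≐ X +ᴹ Z →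
    vert G X → vert G Z → vert G Y
  face-extreme G {X} {Z} {Y} {Y′} vY vY′ sums onX onZ =
    face-balanced G (pair X Z) (pair Y Y′) pairSums (λ { zero → vY ; (suc zero) → vY′ })
      (λ { zero → onX ; (suc zero) → onZ }) zero
    where
    pair : Mat n → Mat n → Fin 2 → Mat n
    pair A B zero    = A
    pair A B (suc _) = B
    pairSums : ∑ᴹ (pair X Z) ≐ ∑ᴹ (pair Y Y′)
    pairSums i j = trans (sym (ℤP.+-assoc (X i j) (Z i j) 0ℤ))
                   (trans (cong (_+ 0ℤ) (sym (sums i j))) (ℤP.+-assoc (Y i j) (Y′ i j) 0ℤ))

  integerFace : (w : Mat n) (m : ℤ) → (∀ A → V A → ⟨ w , A ⟩ℤ ≤ m) → Face V
  integerFace w m bound = record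
    { c = λ i j → toℚ (w i j) ; b = toℚ m
    ; valid = λ A vA → ℚP.≤-trans (ℚP.≤-reflexive (dot-toℚ w A)) (toℚ-mono-≤ (bound A vA)) }

  vert-integerFace⁺ : ∀ w m bound {A} → V A → ⟨ w , A ⟩ℤ ≡ m → vert (integerFace w m bound) A
  vert-integerFace⁺ w m bound {A} vA ≡m = vA , trans (dot-toℚ w A) (cong toℚ ≡m)

  vert-integerFace⁻ : ∀ w m bound {A} → vert (integerFace w m bound) A → ⟨ w , A ⟩ℤ ≡ m
  vert-integerFace⁻ w m bound {A} (_ , on) = toℚ-injective (trans (sym (dot-toℚ w A)) on)

  faceWhen : ∀ {P : Set} → Dec P → Face V → Face V
  faceWhen (yes _) G = G
  faceWhen (no _)  G = wholeFace

  vert-faceWhen⁺ : ∀ {P} (P? : Dec P) G {A} → V A → (P → vert G A) → vert (faceWhen P? G) A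
  vert-faceWhen⁺ (yes p) G vA onG = onG p
  vert-faceWhen⁺ (no _)  G vA onG = vert-wholeFace vA

  vert-faceWhen⁻ : ∀ {P} (P? : Dec P) G {A} → vert (faceWhen P? G) A → P → vert G A
  vert-faceWhen⁻ (yes _) G on p = on
  vert-faceWhen⁻ (no ¬p) G on p = ⊥-elim (¬p p)

Bit : ℤ → Set
Bit z = z ≡ 0ℤ ⊎ z ≡ 1ℤ

-- sumFrom f k = Σ_{j ≥ k} f j for every k : ℕ (so it is 0 for k ≥ n)
sumFrom : ∀ {n} → (Fin n → ℤ) → ℕ → ℤ
sumFrom {zero}  f k       = 0ℤ
sumFrom {suc n} f zero    = f zero + sumFrom (f ∘ suc) zero
sumFrom {suc n} f (suc k) = sumFrom (f ∘ suc) k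

sumFrom-0 : ∀ {n} (f : Fin n → ℤ) → sumFrom f 0 ≡ Σℤ f
sumFrom-0 {zero}  f = refl
sumFrom-0 {suc n} f = cong (λ s → f zero + s) (sumFrom-0 (f ∘ suc))

sumFrom-step : ∀ {n} (f : Fin n → ℤ) (j : Fin n) → sumFrom f (toℕ j) ≡ f j + sumFrom f (suc (toℕ j))
sumFrom-step f zero    = refl
sumFrom-step f (suc j) = sumFrom-step (f ∘ suc) j

sumFrom-≥ : ∀ {n} (f : Fin n → ℤ) {k} → n ℕ.≤ k → sumFrom f k ≡ 0ℤ
sumFrom-≥ {zero}  f n≤k       = refl
sumFrom-≥ {suc n} f (s≤s n≤k) = sumFrom-≥ (f ∘ suc) n≤k

sumFrom-cong : ∀ {n} {f g : Fin n → ℤ} → (∀ i → f i ≡ g i) → ∀ k → sumFrom f k ≡ sumFrom g k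
sumFrom-cong {zero}  f≡g k       = refl
sumFrom-cong {suc n} f≡g zero    = cong₂ _+_ (f≡g zero) (sumFrom-cong (f≡g ∘ suc) zero)
sumFrom-cong {suc n} f≡g (suc k) = sumFrom-cong (f≡g ∘ suc) k

sumFrom-0ℤ : ∀ {n} k → sumFrom {n} (λ _ → 0ℤ) k ≡ 0ℤ
sumFrom-0ℤ {zero}  k       = refl
sumFrom-0ℤ {suc n} zero    = trans (ℤP.+-identityˡ _) (sumFrom-0ℤ {n} zero)
sumFrom-0ℤ {suc n} (suc k) = sumFrom-0ℤ {n} k

sumFrom-+ : ∀ {n} (f g : Fin n → ℤ) k → sumFrom (λ i → f i + g i) k ≡ sumFrom f k + sumFrom g k
sumFrom-+ {zero}  f g k       = refl
sumFrom-+ {suc n} f g (suc k) = sumFrom-+ (f ∘ suc) (g ∘ suc) k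
sumFrom-+ {suc n} f g zero    =
  trans (cong (λ s → f zero + g zero + s) (sumFrom-+ (f ∘ suc) (g ∘ suc) zero))
        (+-interchange (f zero) (g zero) _ _)

sumFrom-neg : ∀ {n} (f : Fin n → ℤ) k → sumFrom (λ i → - f i) k ≡ - sumFrom f k
sumFrom-neg {zero}  f k       = refl
sumFrom-neg {suc n} f (suc k) = sumFrom-neg (f ∘ suc) k
sumFrom-neg {suc n} f zero    =
  trans (cong (λ s → - f zero + s) (sumFrom-neg (f ∘ suc) zero)) (sym (ℤP.neg-distrib-+ (f zero) _))

sumFrom-- : ∀ {n} (f g : Fin n → ℤ) k → sumFrom (λ i → f i - g i) k ≡ sumFrom f k - sumFrom g k
sumFrom-- f g k = trans (sumFrom-+ f (λ i → - g i) k) (cong (λ s → sumFrom f k + s) (sumFrom-neg g k))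

sumFrom-telescope : ∀ {n} (d : ℕ → ℤ) {k} → k ℕ.≤ n →
  sumFrom {n} (λ j → d (toℕ j) - d (suc (toℕ j))) k ≡ d k - d n
sumFrom-telescope {zero}  d z≤n       = sym (ℤP.+-inverseʳ (d 0))
sumFrom-telescope {suc n} d (s≤s k≤n) = sumFrom-telescope (d ∘ suc) k≤n
sumFrom-telescope {suc n} d z≤n       =
  trans (cong (λ s → d 0 - d 1 + s) (sumFrom-telescope (d ∘ suc) z≤n)) (chain (d 0) (d 1) (d (suc n)))
  where
  chain : ∀ a b c → a - b + (b - c) ≡ a - c
  chain = solve-∀

Alternating-tail : ∀ {n} (r : Fin (suc n) → ℤ) → Alternating r → Alternating (r ∘ suc)
Alternating-tail r alt j k j<k rj≢0 rk≢0 between =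
  alt (suc j) (suc k) (s≤s j<k) rj≢0 rk≢0 λ
    { zero () _
    ; (suc l) (s≤s j<l) (s≤s l<k) → between l j<l l<k }

FirstNonzero LastNonzero : ∀ {n} → (Fin n → ℤ) → ℤ → Set
FirstNonzero {n} r v = Σ (Fin n) λ t → r t ≡ v × v ≢ 0ℤ × (∀ u → u Fin.< t → r u ≡ 0ℤ)
LastNonzero  {n} r v = Σ (Fin n) λ t → r t ≡ v × v ≢ 0ℤ × (∀ u → t Fin.< u → r u ≡ 0ℤ)

FirstNonzero-head : ∀ {n} (r : Fin (suc n) → ℤ) → r zero ≢ 0ℤ → FirstNonzero r (r zero)
FirstNonzero-head r r₀≢0 = zero , refl , r₀≢0 , λ _ ()

FirstNonzero-suc : ∀ {n} (r : Fin (suc n) → ℤ) {v} → r zero ≡ 0ℤ → FirstNonzero (r ∘ suc) v → FirstNonzero r v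
FirstNonzero-suc r r₀≡0 (t , rt≡v , v≢0 , before) = suc t , rt≡v , v≢0 , λ
  { zero    _         → r₀≡0
  ; (suc u) (s≤s u<t) → before u u<t }

LastNonzero-suc : ∀ {n} (r : Fin (suc n) → ℤ) {v} → LastNonzero (r ∘ suc) v → LastNonzero r v
LastNonzero-suc r (t , rt≡v , v≢0 , after) = suc t , rt≡v , v≢0 , λ
  { zero    ()
  ; (suc u) (s≤s t<u) → after u t<u }

LastNonzero-unique : ∀ {n} (r : Fin n → ℤ) {v w} → LastNonzero r v → LastNonzero r w → v ≡ w
LastNonzero-unique r (t , rt≡v , v≢0 , afterT) (u , ru≡w , w≢0 , afterU) with ℕP.<-cmp (toℕ t) (toℕ u)
... | tri< t<u _ _ = ⊥-elim (w≢0 (trans (sym ru≡w) (afterT u t<u)))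
... | tri> _ _ u<t = ⊥-elim (v≢0 (trans (sym rt≡v) (afterU t u<t)))
... | tri≈ _ t≡u _ = trans (sym rt≡v) (trans (cong r (FinP.toℕ-injective t≡u)) ru≡w)

head-alternates : ∀ {n} (r : Fin (suc n) → ℤ) → Alternating r → r zero ≢ 0ℤ →
  ∀ {v} → FirstNonzero (r ∘ suc) v → r zero ≡ - v
head-alternates {n} r alt r₀≢0 (t , rt≡v , v≢0 , before) =
  trans (alt zero (suc t) (s≤s z≤n) r₀≢0 (λ rt≡0 → v≢0 (trans (sym rt≡v) rt≡0)) between) (cong -_ rt≡v)
  where
  between : ∀ u → zero {n} Fin.< u → u Fin.< suc t → r u ≡ 0ℤ
  between (suc u) _ (s≤s u<t) = before u u<t

-- The nonzero entries of an alternating vector cancel in pairs, so its sum is 0 or its last nonzero entry,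
-- according as the first and last nonzero entries differ or agree.
data SumShape {n} (r : Fin n → ℤ) : Set where
  zeros      : (∀ t → r t ≡ 0ℤ) → SumShape r
  cancelling : ∀ {l} → FirstNonzero r (- l) → LastNonzero r l → Σℤ r ≡ 0ℤ → SumShape r
  surviving  : ∀ {l} → FirstNonzero r l → LastNonzero r l → Σℤ r ≡ l → SumShape r

sumShape : ∀ {n} (r : Fin n → ℤ) → Alternating r → SumShape r
sumShape {zero}  r alt = zeros λ ()
sumShape {suc n} r alt with sumShape (r ∘ suc) (Alternating-tail r alt) | r zero ℤP.≟ 0ℤ
... | zeros tail≡0 | yes r₀≡0 = zeros λ { zero → r₀≡0 ; (suc t) → tail≡0 t }
... | zeros tail≡0 | no r₀≢0 =
  surviving (FirstNonzero-head r r₀≢0) (zero , refl , r₀≢0 , λ { (suc u) _ → tail≡0 u })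
    (trans (cong (λ s → r zero + s) (ℤSum.∑-ε tail≡0)) (ℤP.+-identityʳ _))
... | cancelling first last Σ≡0 | yes r₀≡0 =
  cancelling (FirstNonzero-suc r r₀≡0 first) (LastNonzero-suc r last)
    (trans (cong₂ _+_ r₀≡0 Σ≡0) refl)
... | surviving first last Σ≡l | yes r₀≡0 =
  surviving (FirstNonzero-suc r r₀≡0 first) (LastNonzero-suc r last)
    (trans (cong (_+ Σℤ (r ∘ suc)) r₀≡0) (trans (ℤP.+-identityˡ _) Σ≡l))
... | cancelling {l} first last Σ≡0 | no r₀≢0 =
  surviving (subst (FirstNonzero r) r₀≡l (FirstNonzero-head r r₀≢0)) (LastNonzero-suc r last)
    (trans (cong₂ _+_ r₀≡l Σ≡0) (ℤP.+-identityʳ l))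
  where
  r₀≡l : r zero ≡ l
  r₀≡l = trans (head-alternates r alt r₀≢0 first) (ℤP.neg-involutive l)
... | surviving {l} first last Σ≡l | no r₀≢0 =
  cancelling (subst (FirstNonzero r) r₀≡-l (FirstNonzero-head r r₀≢0)) (LastNonzero-suc r last)
    (trans (cong₂ _+_ r₀≡-l Σ≡l) (ℤP.+-inverseˡ l))
  where
  r₀≡-l : r zero ≡ - l
  r₀≡-l = head-alternates r alt r₀≢0 first

sumFrom-alternating : ∀ {n} (r : Fin n → ℤ) → Alternating r →
  ∀ k → sumFrom r k ≡ 0ℤ ⊎ Σ ℤ λ l → LastNonzero r l × sumFrom r k ≡ l
sumFrom-alternating {zero}  r alt k = inj₁ refl
sumFrom-alternating {suc n} r alt zero with sumShape r alt
... | zeros r≡0              = inj₁ (trans (sumFrom-0 r) (ℤSum.∑-ε r≡0))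
... | cancelling _ _ Σ≡0     = inj₁ (trans (sumFrom-0 r) Σ≡0)
... | surviving _ last Σ≡l   = inj₂ (_ , last , trans (sumFrom-0 r) Σ≡l)
sumFrom-alternating {suc n} r alt (suc k) with sumFrom-alternating (r ∘ suc) (Alternating-tail r alt) k
... | inj₁ ≡0               = inj₁ ≡0
... | inj₂ (l , last , ≡l)  = inj₂ (l , LastNonzero-suc r last , ≡l)

alternating⇒sumFrom-bit : ∀ {n} (r : Fin n → ℤ) → Alternating r → Σℤ r ≡ 1ℤ → ∀ k → Bit (sumFrom r k)
alternating⇒sumFrom-bit r alt Σ≡1 k with sumFrom-alternating r alt 0 | sumFrom-alternating r alt k
... | inj₁ total≡0 | _ with () ← trans (sym total≡0) (trans (sumFrom-0 r) Σ≡1)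
... | inj₂ _ | inj₁ ≡0 = inj₁ ≡0
... | inj₂ (l , last , total≡l) | inj₂ (l′ , last′ , ≡l′) =
  inj₂ (trans ≡l′ (trans (LastNonzero-unique r last′ last) (trans (sym total≡l) (trans (sumFrom-0 r) Σ≡1))))

≡+⇒≡- : ∀ {a x b} → a ≡ x + b → x ≡ a - b
≡+⇒≡- {x = x} {b} refl = cancel x b
  where
  cancel : ∀ x b → x ≡ x + b - b
  cancel = solve-∀

bit-difference : ∀ {a x b} → Bit a → Bit b → a ≡ x + b → x ≡ 0ℤ ⊎ (x ≡ 1ℤ ⊎ x ≡ -1ℤ)
bit-difference {a} {x} {b} bitA bitB a≡x+b with ≡+⇒≡- {a} {x} {b} a≡x+b
bit-difference (inj₁ refl) (inj₁ refl) _ | refl = inj₁ refl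
bit-difference (inj₁ refl) (inj₂ refl) _ | refl = inj₂ (inj₂ refl)
bit-difference (inj₂ refl) (inj₁ refl) _ | refl = inj₂ (inj₁ refl)
bit-difference (inj₂ refl) (inj₂ refl) _ | refl = inj₁ refl

bit-differences-alternate : ∀ {a b x y z} → Bit x → Bit y → Bit z → y ≡ a + x → x ≡ b + z →
  a ≢ 0ℤ → b ≢ 0ℤ → a ≡ - b
bit-differences-alternate {a} {b} {x} {y} {z} bx by bz y≡a+x x≡b+z a≢0 b≢0
  with ≡+⇒≡- {y} {a} {x} y≡a+x | ≡+⇒≡- {x} {b} {z} x≡b+z
bit-differences-alternate (inj₁ refl) (inj₁ refl) _           _ _ a≢0 _   | refl | refl = ⊥-elim (a≢0 refl)
bit-differences-alternate (inj₂ refl) (inj₂ refl) _           _ _ a≢0 _   | refl | refl = ⊥-elim (a≢0 refl)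
bit-differences-alternate (inj₁ refl) (inj₂ refl) (inj₁ refl) _ _ _   b≢0 | refl | refl = ⊥-elim (b≢0 refl)
bit-differences-alternate (inj₁ refl) (inj₂ refl) (inj₂ refl) _ _ _   _   | refl | refl = refl
bit-differences-alternate (inj₂ refl) (inj₁ refl) (inj₁ refl) _ _ _   _   | refl | refl = refl
bit-differences-alternate (inj₂ refl) (inj₁ refl) (inj₂ refl) _ _ _   b≢0 | refl | refl = ⊥-elim (b≢0 refl)

sumFrom-leadingZeros : ∀ {n} (r : Fin n → ℤ) (k : Fin n) → (∀ l → toℕ l ℕ.< toℕ k → r l ≡ 0ℤ) →
  sumFrom r 0 ≡ sumFrom r (toℕ k)
sumFrom-leadingZeros r zero    _      = refl
sumFrom-leadingZeros r (suc k) zeroes =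
  trans (cong (_+ sumFrom (r ∘ suc) 0) (zeroes zero (s≤s z≤n)))
        (trans (ℤP.+-identityˡ _) (sumFrom-leadingZeros (r ∘ suc) k λ l l<k → zeroes (suc l) (s≤s l<k)))

sumFrom-gap : ∀ {n} (r : Fin n → ℤ) (j k : Fin n) → j Fin.< k → (∀ l → j Fin.< l → l Fin.< k → r l ≡ 0ℤ) →
  sumFrom r (suc (toℕ j)) ≡ sumFrom r (toℕ k)
sumFrom-gap r zero    (suc k) _         zeroes =
  sumFrom-leadingZeros (r ∘ suc) k λ l l<k → zeroes (suc l) (s≤s z≤n) (s≤s l<k)
sumFrom-gap r (suc j) (suc k) (s≤s j<k) zeroes =
  sumFrom-gap (r ∘ suc) j k j<k λ l j<l l<k → zeroes (suc l) (s≤s j<l) (s≤s l<k)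

sumFrom-bit⇒entry : ∀ {n} (r : Fin n → ℤ) → (∀ k → Bit (sumFrom r k)) →
  ∀ j → r j ≡ 0ℤ ⊎ (r j ≡ 1ℤ ⊎ r j ≡ -1ℤ)
sumFrom-bit⇒entry r bits j = bit-difference (bits (toℕ j)) (bits (suc (toℕ j))) (sumFrom-step r j)

sumFrom-bit⇒alternating : ∀ {n} (r : Fin n → ℤ) → (∀ k → Bit (sumFrom r k)) → Alternating r
sumFrom-bit⇒alternating r bits j k j<k rj≢0 rk≢0 between =
  bit-differences-alternate (bits (suc (toℕ j))) (bits (toℕ j)) (bits (suc (toℕ k)))
    (sumFrom-step r j) (trans (sumFrom-gap r j k j<k between) (sumFrom-step r k)) rj≢0 rk≢0

record BitPartialSums {n} (Y : Mat n) : Set where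
  field
    rowBit   : ∀ i k → Bit (sumFrom (Y i) k)
    colBit   : ∀ j k → Bit (sumFrom (λ i → Y i j) k)
    rowTotal : ∀ i → Σℤ (Y i) ≡ 1ℤ
    colTotal : ∀ j → Σℤ (λ i → Y i j) ≡ 1ℤ

asm⇒bitPartialSums : ∀ {n} {Y : Mat n} → IsASM Y → BitPartialSums Y
asm⇒bitPartialSums {Y = Y} asm = record
  { rowBit   = λ i → alternating⇒sumFrom-bit (Y i) (rowAlt i) (rowSum i)
  ; colBit   = λ j → alternating⇒sumFrom-bit (λ i → Y i j) (colAlt j) (colSum j)
  ; rowTotal = rowSum
  ; colTotal = colSum }
  where open IsASM asm

bitPartialSums⇒asm : ∀ {n} {Y : Mat n} → BitPartialSums Y → IsASM Y
bitPartialSums⇒asm {Y = Y} sums = record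
  { entries = λ i → sumFrom-bit⇒entry (Y i) (rowBit i)
  ; rowSum  = rowTotal
  ; colSum  = colTotal
  ; rowAlt  = λ i → sumFrom-bit⇒alternating (Y i) (rowBit i)
  ; colAlt  = λ j → sumFrom-bit⇒alternating (λ i → Y i j) (colBit j) }
  where open BitPartialSums sums

UnitStep : ℤ → ℤ → Set
UnitStep p q = q ≤ p × p ≤ sucℤ q

bit-between : ∀ {z} → 0ℤ ≤ z → z ≤ 1ℤ → Bit z
bit-between {ℤ.+ zero}        _ _                  = inj₁ refl
bit-between {ℤ.+ suc zero}    _ _                  = inj₂ refl
bit-between {ℤ.+ suc (suc n)} _ (ℤ.+≤+ (s≤s ()))
bit-between { -[1+ n ]}       () _

unitStep⇒bit : ∀ {p q} → UnitStep p q → Bit (p - q)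
unitStep⇒bit {p} {q} (q≤p , p≤1+q) =
  bit-between (ℤP.i≤j⇒0≤j-i q≤p) (ℤP.≤-trans (ℤP.+-monoˡ-≤ (- q) p≤1+q) (ℤP.≤-reflexive (cancel q)))
  where
  cancel : ∀ q → 1ℤ + q - q ≡ 1ℤ
  cancel = solve-∀

bit⇒unitStep : ∀ {s} q → Bit s → UnitStep (s + q) q
bit⇒unitStep q (inj₁ refl) = ℤP.≤-reflexive (sym (ℤP.+-identityˡ q)) , ℤP.≤-trans (ℤP.≤-reflexive (ℤP.+-identityˡ q)) (ℤP.i≤suc[i] q)
bit⇒unitStep q (inj₂ refl) = ℤP.i≤suc[i] q , ℤP.≤-refl

unitStep-⊓ : ∀ {p q r s} → UnitStep p q → UnitStep r s → UnitStep (p ⊓ r) (q ⊓ s)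
unitStep-⊓ {q = q} {s = s} (q≤p , p≤1+q) (s≤r , r≤1+s) =
  ℤP.⊓-mono-≤ q≤p s≤r ,
  ℤP.≤-trans (ℤP.⊓-mono-≤ p≤1+q r≤1+s) (ℤP.≤-reflexive (sym (ℤP.mono-≤-distrib-⊓ ℤP.suc-mono q s)))

unitStep-⊔ : ∀ {p q r s} → UnitStep p q → UnitStep r s → UnitStep (p ⊔ r) (q ⊔ s)
unitStep-⊔ {q = q} {s = s} (q≤p , p≤1+q) (s≤r , r≤1+s) =
  ℤP.⊔-mono-≤ q≤p s≤r ,
  ℤP.≤-trans (ℤP.⊔-mono-≤ p≤1+q r≤1+s) (ℤP.≤-reflexive (sym (ℤP.mono-≤-distrib-⊔ ℤP.suc-mono q s)))

unitStep-suc : ∀ {p q} → UnitStep p q → UnitStep (sucℤ p) (sucℤ q)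
unitStep-suc (q≤p , p≤1+q) = ℤP.suc-mono q≤p , ℤP.suc-mono p≤1+q

unitStep-pred : ∀ {p q} → UnitStep p q → UnitStep (pred p) (pred q)
unitStep-pred {p} {q} (q≤p , p≤1+q) =
  ℤP.pred-mono q≤p , ℤP.≤-trans (ℤP.pred-mono p≤1+q) (ℤP.≤-reflexive (trans (ℤP.pred-suc q) (sym (ℤP.suc-pred q))))

height : ∀ {n} → Mat n → ℕ → ℕ → ℤ
height X a b = sumFrom (λ i → sumFrom (X i) b) a

record IsHeight (n : ℕ) (h : ℕ → ℕ → ℤ) : Set where
  field
    rowStep  : ∀ (i : Fin n) b → UnitStep (h (toℕ i) b) (h (suc (toℕ i)) b)
    colStep  : ∀ (j : Fin n) a → UnitStep (h a (toℕ j)) (h a (suc (toℕ j)))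
    lastCol  : ∀ a → h a n ≡ 0ℤ
    lastRow  : ∀ b → h n b ≡ 0ℤ
    rowTotal : ∀ (i : Fin n) → h (toℕ i) 0 ≡ sucℤ (h (suc (toℕ i)) 0)
    colTotal : ∀ (j : Fin n) → h 0 (toℕ j) ≡ sucℤ (h 0 (suc (toℕ j)))

fromHeight : ∀ {n} → (ℕ → ℕ → ℤ) → Mat n
fromHeight h i j = (h (toℕ i) (toℕ j) - h (suc (toℕ i)) (toℕ j)) - (h (toℕ i) (suc (toℕ j)) - h (suc (toℕ i)) (suc (toℕ j)))

height-row : ∀ {n} (X : Mat n) (i : Fin n) b → height X (toℕ i) b ≡ sumFrom (X i) b + height X (suc (toℕ i)) b
height-row X i b = sumFrom-step (λ i → sumFrom (X i) b) i

height-col : ∀ {n} (X : Mat n) (j : Fin n) a →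
  height X a (toℕ j) ≡ sumFrom (λ i → X i j) a + height X a (suc (toℕ j))
height-col X j a =
  trans (sumFrom-cong (λ i → sumFrom-step (X i) j) a) (sumFrom-+ (λ i → X i j) (λ i → sumFrom (X i) (suc (toℕ j))) a)

height-≥ʳ : ∀ {n} (X : Mat n) {a} b → n ℕ.≤ a → height X a b ≡ 0ℤ
height-≥ʳ X b n≤a = sumFrom-≥ _ n≤a

height-≥ᶜ : ∀ {n} (X : Mat n) a {b} → n ℕ.≤ b → height X a b ≡ 0ℤ
height-≥ᶜ {n} X a n≤b = trans (sumFrom-cong (λ i → sumFrom-≥ (X i) n≤b) a) (sumFrom-0ℤ {n} a)

height-cong : ∀ {n} {A B : Mat n} → A ≐ B → ∀ a b → height A a b ≡ height B a b
height-cong A≐B a b = sumFrom-cong (λ i → sumFrom-cong (A≐B i) b) a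

height-+- : ∀ {n} (A B C : Mat n) a b → height (A +ᴹ B -ᴹ C) a b ≡ height A a b + height B a b - height C a b
height-+- A B C a b =
  trans (sumFrom-cong rowwise a)
    (trans (sumFrom-- (λ i → sumFrom (A i) b + sumFrom (B i) b) (λ i → sumFrom (C i) b) a)
           (cong (_- height C a b) (sumFrom-+ (λ i → sumFrom (A i) b) (λ i → sumFrom (B i) b) a)))
  where
  rowwise : ∀ i → sumFrom ((A +ᴹ B -ᴹ C) i) b ≡ sumFrom (A i) b + sumFrom (B i) b - sumFrom (C i) b
  rowwise i = trans (sumFrom-- (λ j → A i j + B i j) (C i) b) (cong (_- sumFrom (C i) b) (sumFrom-+ (A i) (B i) b))

height-isHeight : ∀ {n} {X : Mat n} → IsASM X → IsHeight n (height X)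
height-isHeight {n} {X} asm = record
  { rowStep  = λ i b → subst (λ p → UnitStep p (height X (suc (toℕ i)) b)) (sym (height-row X i b))
                              (bit⇒unitStep _ (rowBit i b))
  ; colStep  = λ j a → subst (λ p → UnitStep p (height X a (suc (toℕ j)))) (sym (height-col X j a))
                              (bit⇒unitStep _ (colBit j a))
  ; lastCol  = λ a → height-≥ᶜ X a ℕP.≤-refl
  ; lastRow  = λ b → height-≥ʳ X b ℕP.≤-refl
  ; rowTotal = λ i → trans (height-row X i 0) (cong (_+ height X (suc (toℕ i)) 0) (trans (sumFrom-0 (X i)) (rowTotal i)))
  ; colTotal = λ j → trans (height-col X j 0) (cong (_+ height X 0 (suc (toℕ j))) (trans (sumFrom-0 (λ i → X i j)) (colTotal j)))
  }
  where open BitPartialSums (asm⇒bitPartialSums asm)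

fromHeight-transpose : ∀ {n} (h : ℕ → ℕ → ℤ) (i j : Fin n) →
  fromHeight h i j ≡ (h (toℕ i) (toℕ j) - h (toℕ i) (suc (toℕ j))) - (h (suc (toℕ i)) (toℕ j) - h (suc (toℕ i)) (suc (toℕ j)))
fromHeight-transpose h i j = swap (h (toℕ i) (toℕ j)) (h (suc (toℕ i)) (toℕ j)) (h (toℕ i) (suc (toℕ j))) (h (suc (toℕ i)) (suc (toℕ j)))
  where
  swap : ∀ a b c d → (a - b) - (c - d) ≡ (a - c) - (b - d)
  swap = solve-∀

module _ {n} {h : ℕ → ℕ → ℤ} (isHeight : IsHeight n h) where
  open IsHeight isHeight

  private
    minus-zeros : ∀ {a b} → a ≡ 0ℤ → b ≡ 0ℤ → ∀ x → x - (a - b) ≡ x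
    minus-zeros refl refl x = ℤP.+-identityʳ x

  fromHeight-rowSum : ∀ (i : Fin n) {k} → k ℕ.≤ n → sumFrom (fromHeight h i) k ≡ h (toℕ i) k - h (suc (toℕ i)) k
  fromHeight-rowSum i k≤n =
    trans (sumFrom-telescope (λ b → h (toℕ i) b - h (suc (toℕ i)) b) k≤n) (minus-zeros (lastCol _) (lastCol _) _)

  fromHeight-colSum : ∀ (j : Fin n) {k} → k ℕ.≤ n → sumFrom (λ i → fromHeight h i j) k ≡ h k (toℕ j) - h k (suc (toℕ j))
  fromHeight-colSum j k≤n =
    trans (sumFrom-cong (λ i → fromHeight-transpose h i j) _)
      (trans (sumFrom-telescope (λ a → h a (toℕ j) - h a (suc (toℕ j))) k≤n) (minus-zeros (lastRow _) (lastRow _) _))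

  fromHeight-bitPartialSums : BitPartialSums {n} (fromHeight h)
  fromHeight-bitPartialSums = record
    { rowBit   = rowBit
    ; colBit   = colBit
    ; rowTotal = λ i → trans (sym (sumFrom-0 (fromHeight h i))) (trans (fromHeight-rowSum i z≤n) (total (rowTotal i)))
    ; colTotal = λ j → trans (sym (sumFrom-0 (λ i → fromHeight h i j))) (trans (fromHeight-colSum j z≤n) (total (colTotal j)))
    }
    where
    total : ∀ {p q} → p ≡ sucℤ q → p - q ≡ 1ℤ
    total {q = q} refl = cancel q
      where
      cancel : ∀ q → 1ℤ + q - q ≡ 1ℤ
      cancel = solve-∀
    rowBit : ∀ i k → Bit (sumFrom (fromHeight h i) k)
    rowBit i k with k ℕP.≤? n
    ... | yes k≤n = subst Bit (sym (fromHeight-rowSum i k≤n)) (unitStep⇒bit (rowStep i k))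
    ... | no  k≰n = inj₁ (sumFrom-≥ _ (ℕP.<⇒≤ (ℕP.≰⇒> k≰n)))
    colBit : ∀ j k → Bit (sumFrom (λ i → fromHeight h i j) k)
    colBit j k with k ℕP.≤? n
    ... | yes k≤n = subst Bit (sym (fromHeight-colSum j k≤n)) (unitStep⇒bit (colStep j k))
    ... | no  k≰n = inj₁ (sumFrom-≥ _ (ℕP.<⇒≤ (ℕP.≰⇒> k≰n)))

  fromHeight-isASM : IsASM {n} (fromHeight h)
  fromHeight-isASM = bitPartialSums⇒asm fromHeight-bitPartialSums

  height-fromHeight : ∀ {a b} → a ℕ.≤ n → b ℕ.≤ n → height {n} (fromHeight h) a b ≡ h a b
  height-fromHeight {a} {b} a≤n b≤n =
    trans (sumFrom-cong (λ i → fromHeight-rowSum i b≤n) a)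
      (trans (sumFrom-telescope (λ a → h a b) a≤n) (trans (cong (λ t → h a b - t) (lastRow b)) (ℤP.+-identityʳ _)))

fromHeight-height : ∀ {n} (X : Mat n) → fromHeight (height X) ≐ X
fromHeight-height X i j =
  trans (cong₂ _-_ (sym (≡+⇒≡- {height X a b} {sumFrom (X i) b} {height X (suc a) b} (height-row X i b)))
                    (sym (≡+⇒≡- {height X a (suc b)} {sumFrom (X i) (suc b)} {height X (suc a) (suc b)} (height-row X i (suc b)))))
        (sym (≡+⇒≡- {sumFrom (X i) b} {X i j} {sumFrom (X i) (suc b)} (sumFrom-step (X i) j)))
  where
  a = toℕ i
  b = toℕ j

fromHeight-cong : ∀ {n} {g g′ : ℕ → ℕ → ℤ} → (∀ {a b} → a ℕ.≤ n → b ℕ.≤ n → g a b ≡ g′ a b) →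
  fromHeight {n} g ≐ fromHeight g′
fromHeight-cong g≡g′ i j = cong₂ _-_ (cong₂ _-_ (g≡g′ i≤n j≤n) (g≡g′ i<n j≤n)) (cong₂ _-_ (g≡g′ i≤n j<n) (g≡g′ i<n j<n))
  where
  i<n = FinP.toℕ<n i
  j<n = FinP.toℕ<n j
  i≤n = ℕP.<⇒≤ i<n
  j≤n = ℕP.<⇒≤ j<n

fromHeight-+ : ∀ {n} (g g′ : ℕ → ℕ → ℤ) → fromHeight {n} (λ a b → g a b + g′ a b) ≐ fromHeight g +ᴹ fromHeight g′
fromHeight-+ g g′ i j = regroup (g a b) (g a′ b) (g a b′) (g a′ b′) (g′ a b) (g′ a′ b) (g′ a b′) (g′ a′ b′)
  where
  a = toℕ i
  a′ = suc (toℕ i)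
  b = toℕ j
  b′ = suc (toℕ j)
  regroup : ∀ x y z w x′ y′ z′ w′ →
    ((x + x′) - (y + y′)) - ((z + z′) - (w + w′)) ≡ ((x - y) - (z - w)) + ((x′ - y′) - (z′ - w′))
  regroup = solve-∀

fromHeight-splits : ∀ {n} (X Z : Mat n) (g g′ : ℕ → ℕ → ℤ) →
  (∀ a b → g a b + g′ a b ≡ height X a b + height Z a b) → fromHeight g +ᴹ fromHeight g′ ≐ X +ᴹ Z
fromHeight-splits X Z g g′ sums i j =
  trans (sym (fromHeight-+ g g′ i j))
    (trans (fromHeight-cong (λ {a} {b} _ _ → sums a b) i j)
      (trans (fromHeight-+ (height X) (height Z) i j) (cong₂ _+_ (fromHeight-height X i j) (fromHeight-height Z i j))))

record HeightOperation (_∙_ : ℤ → ℤ → ℤ) : Set where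
  field
    unitStep : ∀ {p q r s} → UnitStep p q → UnitStep r s → UnitStep (p ∙ r) (q ∙ s)
    sucℤ-∙   : ∀ x y → sucℤ x ∙ sucℤ y ≡ sucℤ (x ∙ y)
    0ℤ-∙     : 0ℤ ∙ 0ℤ ≡ 0ℤ

isHeight-∙ : ∀ {_∙_} → HeightOperation _∙_ → ∀ {n h₁ h₂} → IsHeight n h₁ → IsHeight n h₂ →
  IsHeight n (λ a b → h₁ a b ∙ h₂ a b)
isHeight-∙ {_∙_} op H₁ H₂ = record
  { rowStep  = λ i b → unitStep (H₁.rowStep i b) (H₂.rowStep i b)
  ; colStep  = λ j a → unitStep (H₁.colStep j a) (H₂.colStep j a)
  ; lastCol  = λ a → trans (cong₂ _∙_ (H₁.lastCol a) (H₂.lastCol a)) 0ℤ-∙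
  ; lastRow  = λ b → trans (cong₂ _∙_ (H₁.lastRow b) (H₂.lastRow b)) 0ℤ-∙
  ; rowTotal = λ i → trans (cong₂ _∙_ (H₁.rowTotal i) (H₂.rowTotal i)) (sucℤ-∙ _ _)
  ; colTotal = λ j → trans (cong₂ _∙_ (H₁.colTotal j) (H₂.colTotal j)) (sucℤ-∙ _ _)
  }
  where
  open HeightOperation op
  module H₁ = IsHeight H₁
  module H₂ = IsHeight H₂

⊓-heightOperation : HeightOperation _⊓_
⊓-heightOperation = record
  { unitStep = unitStep-⊓
  ; sucℤ-∙   = λ x y → sym (ℤP.mono-≤-distrib-⊓ ℤP.suc-mono x y)
  ; 0ℤ-∙     = refl }

⊔-heightOperation : HeightOperation _⊔_
⊔-heightOperation = record
  { unitStep = unitStep-⊔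
  ; sucℤ-∙   = λ x y → sym (ℤP.mono-≤-distrib-⊔ ℤP.suc-mono x y)
  ; 0ℤ-∙     = refl }

suc-⊓-heightOperation : HeightOperation (λ x y → sucℤ x ⊓ y)
suc-⊓-heightOperation = record
  { unitStep = λ s₁ s₂ → unitStep-⊓ (unitStep-suc s₁) s₂
  ; sucℤ-∙   = λ x y → sym (ℤP.mono-≤-distrib-⊓ ℤP.suc-mono (sucℤ x) y)
  ; 0ℤ-∙     = refl }

⊔-pred-heightOperation : HeightOperation (λ x y → x ⊔ pred y)
⊔-pred-heightOperation = record
  { unitStep = λ s₁ s₂ → unitStep-⊔ s₁ (unitStep-pred s₂)
  ; sucℤ-∙   = λ x y → trans (cong (sucℤ x ⊔_) (trans (ℤP.pred-suc y) (sym (ℤP.suc-pred y))))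
                             (sym (ℤP.mono-≤-distrib-⊔ ℤP.suc-mono x (pred y)))
  ; 0ℤ-∙     = refl }

⊓-+-⊔ : ∀ x y → (x ⊓ y) + (x ⊔ y) ≡ x + y
⊓-+-⊔ x y with ℤP.≤-total x y
... | inj₁ x≤y = cong₂ _+_ (ℤP.i≤j⇒i⊓j≡i x≤y) (ℤP.i≤j⇒i⊔j≡j x≤y)
... | inj₂ y≤x = trans (cong₂ _+_ (ℤP.i≥j⇒i⊓j≡j y≤x) (ℤP.i≥j⇒i⊔j≡i y≤x)) (ℤP.+-comm y x)

suc-⊓-+-⊔-pred : ∀ x y → (sucℤ x ⊓ y) + (x ⊔ pred y) ≡ x + y
suc-⊓-+-⊔-pred x y = begin
  m + (x ⊔ pred y)        ≡⟨ cong (m +_) (trans (cong (_⊔ pred y) (sym (ℤP.pred-suc x)))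
                                                (sym (ℤP.mono-≤-distrib-⊔ ℤP.pred-mono (sucℤ x) y))) ⟩
  m + (-1ℤ + j)           ≡⟨ ℤP.+-assoc m -1ℤ j ⟨
  (m + -1ℤ) + j           ≡⟨ cong (_+ j) (ℤP.+-comm m -1ℤ) ⟩
  (-1ℤ + m) + j           ≡⟨ ℤP.+-assoc -1ℤ m j ⟩
  -1ℤ + (m + j)           ≡⟨ cong pred (⊓-+-⊔ (sucℤ x) y) ⟩
  -1ℤ + (sucℤ x + y)      ≡⟨ ℤP.+-assoc -1ℤ (sucℤ x) y ⟨
  pred (sucℤ x) + y       ≡⟨ cong (_+ y) (ℤP.pred-suc x) ⟩
  x + y                   ∎
  where
  open ≡-Reasoning
  m = sucℤ x ⊓ y
  j = sucℤ x ⊔ y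

suc-cancel-≤ : ∀ {i j} → sucℤ i ≤ sucℤ j → i ≤ j
suc-cancel-≤ {i} {j} 1+i≤1+j = subst₂ _≤_ (ℤP.pred-suc i) (ℤP.pred-suc j) (ℤP.pred-mono 1+i≤1+j)

sandwich-suc : ∀ {i j} → i ≤ j → j ≤ sucℤ i → j ≡ i ⊎ j ≡ sucℤ i
sandwich-suc {i} {j} i≤j j≤1+i with j ℤP.≟ sucℤ i
... | yes j≡1+i = inj₂ j≡1+i
... | no  j≢1+i = inj₁ (ℤP.≤-antisym (subst (j ≤_) (ℤP.pred-suc i) (ℤP.i<j⇒i≤pred[j] (ℤP.≤∧≢⇒< j≤1+i j≢1+i))) i≤j)

≢-by-difference : ∀ {x y d} → x - y ≡ d → d ≢ 0ℤ → x ≢ y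
≢-by-difference {x} x-y≡d d≢0 refl = d≢0 (trans (sym x-y≡d) (ℤP.+-inverseʳ x))

bits-combination : ∀ {x y z} → Bit x → Bit y → Bit z → Bit (x + y - z) ⊎ (x ≡ y × z ≢ x)
bits-combination (inj₁ refl) (inj₁ refl) (inj₁ refl) = inj₁ (inj₁ refl)
bits-combination (inj₁ refl) (inj₁ refl) (inj₂ refl) = inj₂ (refl , λ ())
bits-combination (inj₁ refl) (inj₂ refl) (inj₁ refl) = inj₁ (inj₂ refl)
bits-combination (inj₁ refl) (inj₂ refl) (inj₂ refl) = inj₁ (inj₁ refl)
bits-combination (inj₂ refl) (inj₁ refl) (inj₁ refl) = inj₁ (inj₂ refl)
bits-combination (inj₂ refl) (inj₁ refl) (inj₂ refl) = inj₁ (inj₁ refl)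
bits-combination (inj₂ refl) (inj₂ refl) (inj₁ refl) = inj₂ (refl , λ ())
bits-combination (inj₂ refl) (inj₂ refl) (inj₂ refl) = inj₁ (inj₂ refl)

both-step-up : ∀ {pᵢ pₘ pⱼ qᵢ qₘ qⱼ} → pᵢ ≤ pₘ → pₘ ≤ pⱼ → pⱼ ≤ sucℤ pᵢ → qᵢ ≤ qₘ → qₘ ≤ qⱼ → qⱼ ≤ sucℤ qᵢ →
  pᵢ - qᵢ ≡ pⱼ - qⱼ → pₘ - qₘ ≢ pᵢ - qᵢ → pⱼ ≡ sucℤ pᵢ × qⱼ ≡ sucℤ qᵢ
both-step-up {pᵢ} {pₘ} {pⱼ} {qᵢ} {qₘ} {qⱼ} pᵢ≤pₘ pₘ≤pⱼ pⱼ≤ qᵢ≤qₘ qₘ≤qⱼ qⱼ≤ vᵢ≡vⱼ vₘ≢vᵢ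
  with sandwich-suc (ℤP.≤-trans pᵢ≤pₘ pₘ≤pⱼ) pⱼ≤ | sandwich-suc (ℤP.≤-trans qᵢ≤qₘ qₘ≤qⱼ) qⱼ≤
... | inj₂ p↑ | inj₂ q↑ = p↑ , q↑
... | inj₁ refl | inj₁ refl =
  ⊥-elim (vₘ≢vᵢ (cong₂ _-_ (ℤP.≤-antisym pₘ≤pⱼ pᵢ≤pₘ) (ℤP.≤-antisym qₘ≤qⱼ qᵢ≤qₘ)))
... | inj₁ refl | inj₂ refl = ⊥-elim (≢-by-difference (up pᵢ qᵢ) (λ ()) vᵢ≡vⱼ)
  where
  up : ∀ p q → p - q - (p - (1ℤ + q)) ≡ 1ℤ
  up = solve-∀
... | inj₂ refl | inj₁ refl = ⊥-elim (≢-by-difference (down pᵢ qᵢ) (λ ()) vᵢ≡vⱼ)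
  where
  down : ∀ p q → p - q - ((1ℤ + p) - q) ≡ -1ℤ
  down = solve-∀

pinned : ∀ {pᵢ pⱼ pₜ qᵢ qⱼ qₜ} → pⱼ ≡ sucℤ pᵢ → qⱼ ≡ sucℤ qᵢ →
  (pₜ ≤ pᵢ × qₜ ≤ qᵢ × pⱼ ≤ sucℤ pₜ × qⱼ ≤ sucℤ qₜ) ⊎ (pⱼ ≤ pₜ × qⱼ ≤ qₜ × pₜ ≤ sucℤ pᵢ × qₜ ≤ sucℤ qᵢ) →
  pₜ - qₜ ≡ pᵢ - qᵢ
pinned refl refl (inj₁ (pₜ≤ , qₜ≤ , ≤pₜ , ≤qₜ)) =
  cong₂ _-_ (ℤP.≤-antisym pₜ≤ (suc-cancel-≤ ≤pₜ)) (ℤP.≤-antisym qₜ≤ (suc-cancel-≤ ≤qₜ))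
pinned {pᵢ} {qᵢ = qᵢ} refl refl (inj₂ (≤pₜ , ≤qₜ , pₜ≤ , qₜ≤)) =
  trans (cong₂ _-_ (ℤP.≤-antisym pₜ≤ ≤pₜ) (ℤP.≤-antisym qₜ≤ ≤qₜ)) (shift pᵢ qᵢ)
  where
  shift : ∀ p q → (1ℤ + p) - (1ℤ + q) ≡ p - q
  shift = solve-∀

reflection-below : ∀ {hᵢ hₘ hⱼ} → hᵢ ≤ hₘ → hₘ ≤ hⱼ → hⱼ ≤ sucℤ hᵢ → hᵢ + hⱼ - hₘ ≤ hₘ → hⱼ ≤ hₘ
reflection-below {hᵢ} {hₘ} {hⱼ} hᵢ≤hₘ hₘ≤hⱼ hⱼ≤ refl≤ with sandwich-suc hᵢ≤hₘ (ℤP.≤-trans hₘ≤hⱼ hⱼ≤)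
... | inj₁ refl = ℤP.≤-trans (ℤP.≤-reflexive (sym (cancel hᵢ hⱼ))) refl≤
  where
  cancel : ∀ i j → i + j - i ≡ j
  cancel = solve-∀
... | inj₂ refl = hⱼ≤

reflection-above : ∀ {hᵢ hₘ hⱼ} → hᵢ ≤ hₘ → hₘ ≤ hⱼ → hⱼ ≤ sucℤ hᵢ → hₘ ≤ hᵢ + hⱼ - hₘ → hₘ ≤ hᵢ
reflection-above {hᵢ} {hₘ} {hⱼ} hᵢ≤hₘ hₘ≤hⱼ hⱼ≤ ≤refl with sandwich-suc hᵢ≤hₘ (ℤP.≤-trans hₘ≤hⱼ hⱼ≤)
... | inj₁ refl = ℤP.≤-refl
... | inj₂ refl = ℤP.≤-trans ≤refl (ℤP.≤-reflexive (trans (cong (λ j → hᵢ + j - sucℤ hᵢ) (ℤP.≤-antisym hⱼ≤ hₘ≤hⱼ)) (cancel hᵢ (sucℤ hᵢ))))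
  where
  cancel : ∀ i m → i + m - m ≡ i
  cancel = solve-∀

data Line : Set where
  row col : Line

lineSum : ∀ {n} → Line → Fin n → ℕ → Mat n → ℤ
lineSum row a k X = sumFrom (X a) k
lineSum col a k X = sumFrom (λ i → X i a) k

lineSum-bit : ∀ {n} {X : Mat n} → IsASM X → ∀ ℓ a k → Bit (lineSum ℓ a k X)
lineSum-bit asm row = BitPartialSums.rowBit (asm⇒bitPartialSums asm)
lineSum-bit asm col = BitPartialSums.colBit (asm⇒bitPartialSums asm)

lineSum-+- : ∀ {n} (A B C : Mat n) ℓ a k →
  lineSum ℓ a k (A +ᴹ B -ᴹ C) ≡ lineSum ℓ a k A + lineSum ℓ a k B - lineSum ℓ a k C
lineSum-+- A B C row a k =
  trans (sumFrom-- (λ j → A a j + B a j) (C a) k) (cong (_- sumFrom (C a) k) (sumFrom-+ (A a) (B a) k))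
lineSum-+- A B C col a k =
  trans (sumFrom-- (λ i → A i a + B i a) (λ i → C i a) k)
        (cong (_- sumFrom (λ i → C i a) k) (sumFrom-+ (λ i → A i a) (λ i → B i a) k))

lineSum-total : ∀ {n} {X : Mat n} → IsASM X → ∀ ℓ a → lineSum ℓ a 0 X ≡ 1ℤ
lineSum-total {X = X} asm row a = trans (sumFrom-0 (X a)) (IsASM.rowSum asm a)
lineSum-total {X = X} asm col a = trans (sumFrom-0 (λ i → X i a)) (IsASM.colSum asm a)

lineSums-determine : ∀ {n} {Y Z : Mat n} → (∀ a k → lineSum row a k Y ≡ lineSum row a k Z) → Y ≐ Z
lineSums-determine {Y = Y} {Z} same i j =
  trans (≡+⇒≡- {sumFrom (Y i) (toℕ j)} {Y i j} {sumFrom (Y i) (suc (toℕ j))} (sumFrom-step (Y i) j))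
    (trans (cong₂ _-_ (same i (toℕ j)) (same i (suc (toℕ j))))
      (sym (≡+⇒≡- {sumFrom (Z i) (toℕ j)} {Z i j} {sumFrom (Z i) (suc (toℕ j))} (sumFrom-step (Z i) j))))

outer inner : ∀ {n} → Line → Fin n → ℕ → ℕ × ℕ
outer row a k = toℕ a , k
outer col a k = k , toℕ a
inner row a k = suc (toℕ a) , k
inner col a k = k , suc (toℕ a)

heightAt : ∀ {n} → Mat n → ℕ × ℕ → ℤ
heightAt X (a , b) = height X a b

lineSum-height : ∀ {n} ℓ a k (X : Mat n) → lineSum ℓ a k X ≡ heightAt X (outer ℓ a k) - heightAt X (inner ℓ a k)
lineSum-height row a k X =
  ≡+⇒≡- {height X (toℕ a) k} {sumFrom (X a) k} {height X (suc (toℕ a)) k} (height-row X a k)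
lineSum-height col a k X =
  ≡+⇒≡- {height X k (toℕ a)} {sumFrom (λ i → X i a) k} {height X k (suc (toℕ a))} (height-col X a k)

δ : ∀ {n} → Fin n → Fin n → ℤ
δ zero    zero    = 1ℤ
δ zero    (suc _) = 0ℤ
δ (suc _) zero    = 0ℤ
δ (suc a) (suc b) = δ a b

𝟙[_≤_] : ∀ {n} → ℕ → Fin n → ℤ
𝟙[ zero  ≤ j     ] = 1ℤ
𝟙[ suc k ≤ zero  ] = 0ℤ
𝟙[ suc k ≤ suc j ] = 𝟙[ k ≤ j ]

Σℤ-δ : ∀ {n} (a : Fin n) (g : Fin n → ℤ) → Σℤ (λ i → δ a i * g i) ≡ g a
Σℤ-δ zero    g = trans (cong₂ _+_ (ℤP.*-identityˡ (g zero)) (ℤSum.∑-ε λ i → ℤP.*-zeroˡ (g (suc i)))) (ℤP.+-identityʳ _)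
Σℤ-δ (suc a) g = trans (cong (_+ Σℤ (λ i → δ a i * g (suc i))) (ℤP.*-zeroˡ (g zero)))
                       (trans (ℤP.+-identityˡ _) (Σℤ-δ a (g ∘ suc)))

Σℤ-𝟙≤ : ∀ {n} k (f : Fin n → ℤ) → Σℤ (λ j → 𝟙[ k ≤ j ] * f j) ≡ sumFrom f k
Σℤ-𝟙≤ {zero}  k       f = refl
Σℤ-𝟙≤ {suc n} zero    f =
  cong₂ _+_ (ℤP.*-identityˡ (f zero))
    (trans (ℤSum.∑-cong λ j → ℤP.*-identityˡ (f (suc j))) (sym (sumFrom-0 (f ∘ suc))))
Σℤ-𝟙≤ {suc n} (suc k) f =
  trans (cong (_+ Σℤ (λ j → 𝟙[ k ≤ j ] * f (suc j))) (ℤP.*-zeroˡ (f zero)))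
        (trans (ℤP.+-identityˡ _) (Σℤ-𝟙≤ k (f ∘ suc)))

lineWeights : ∀ {n} → Line → Fin n → ℕ → Mat n
lineWeights row a k i j = δ a i * 𝟙[ k ≤ j ]
lineWeights col a k i j = 𝟙[ k ≤ i ] * δ a j

⟨lineWeights⟩ : ∀ {n} ℓ (a : Fin n) k (X : Mat n) → ⟨ lineWeights ℓ a k , X ⟩ℤ ≡ lineSum ℓ a k X
⟨lineWeights⟩ {n} row a k X = begin
  Σℤ (λ i → Σℤ λ j → δ a i * 𝟙[ k ≤ j ] * X i j)   ≡⟨ ℤSum.∑-cong {n} (λ i → trans (ℤSum.∑-cong {n} λ j → ℤP.*-assoc (δ a i) _ _)
                                                                                  (Σℤ-*ˡ (δ a i) (λ j → 𝟙[ k ≤ j ] * X i j))) ⟩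
  Σℤ (λ i → δ a i * Σℤ λ j → 𝟙[ k ≤ j ] * X i j)   ≡⟨ Σℤ-δ a _ ⟩
  Σℤ (λ j → 𝟙[ k ≤ j ] * X a j)                    ≡⟨ Σℤ-𝟙≤ k (X a) ⟩
  sumFrom (X a) k                                  ∎
  where open ≡-Reasoning
⟨lineWeights⟩ {n} col a k X = begin
  Σℤ (λ i → Σℤ λ j → 𝟙[ k ≤ i ] * δ a j * X i j)   ≡⟨ ℤSum.∑-cong {n} (λ i → trans (ℤSum.∑-cong {n} λ j → ℤP.*-assoc 𝟙[ k ≤ i ] _ _)
                                                                                  (trans (Σℤ-*ˡ 𝟙[ k ≤ i ] (λ j → δ a j * X i j)) (cong (𝟙[ k ≤ i ] *_) (Σℤ-δ a (X i))))) ⟩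
  Σℤ (λ i → 𝟙[ k ≤ i ] * X i a)                    ≡⟨ Σℤ-𝟙≤ k (λ i → X i a) ⟩
  sumFrom (λ i → X i a) k                          ∎
  where open ≡-Reasoning

lineSum-≥ : ∀ {n} ℓ (a : Fin n) {k} (X : Mat n) → n ℕ.≤ k → lineSum ℓ a k X ≡ 0ℤ
lineSum-≥ row a X n≤k = sumFrom-≥ (X a) n≤k
lineSum-≥ col a X n≤k = sumFrom-≥ (λ i → X i a) n≤k

⟨-⟩ℤ : ∀ {n} (w X : Mat n) → ⟨ (λ i j → - w i j) , X ⟩ℤ ≡ - ⟨ w , X ⟩ℤ
⟨-⟩ℤ {n} w X =
  trans (ℤSum.∑-cong {n} λ i → trans (ℤSum.∑-cong {n} λ j → sym (ℤP.neg-distribˡ-* (w i j) (X i j))) (Σℤ-neg (λ j → w i j * X i j)))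
        (Σℤ-neg (λ i → Σℤ λ j → w i j * X i j))

bit≤1 : ∀ {z} → Bit z → z ≤ 1ℤ
bit≤1 (inj₁ refl) = ℤ.+≤+ z≤n
bit≤1 (inj₂ refl) = ℤP.≤-refl

-bit≤0 : ∀ {z} → Bit z → - z ≤ 0ℤ
-bit≤0 (inj₁ refl) = ℤP.≤-refl
-bit≤0 (inj₂ refl) = ℤ.-≤+

-lineWeights : ∀ {n} → Line → Fin n → ℕ → Mat n
-lineWeights ℓ a k i j = - lineWeights ℓ a k i j

⟨-lineWeights⟩ : ∀ {n} ℓ (a : Fin n) k (X : Mat n) → ⟨ -lineWeights ℓ a k , X ⟩ℤ ≡ - lineSum ℓ a k X
⟨-lineWeights⟩ ℓ a k X = trans (⟨-⟩ℤ (lineWeights ℓ a k) X) (cong -_ (⟨lineWeights⟩ ℓ a k X))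

lineSum≤1 : ∀ {n} ℓ a k (A : Mat n) → IsASM A → ⟨ lineWeights ℓ a k , A ⟩ℤ ≤ 1ℤ
lineSum≤1 ℓ a k A asm = ℤP.≤-trans (ℤP.≤-reflexive (⟨lineWeights⟩ ℓ a k A)) (bit≤1 (lineSum-bit asm ℓ a k))

-lineSum≤0 : ∀ {n} ℓ a k (A : Mat n) → IsASM A → ⟨ -lineWeights ℓ a k , A ⟩ℤ ≤ 0ℤ
-lineSum≤0 ℓ a k A asm = ℤP.≤-trans (ℤP.≤-reflexive (⟨-lineWeights⟩ ℓ a k A)) (-bit≤0 (lineSum-bit asm ℓ a k))

lineSumFace : ∀ {n} → Line → Fin n → ℕ → ∀ {v} → Bit v → Face (IsASM {n})
lineSumFace ℓ a k (inj₁ _) = integerFace (-lineWeights ℓ a k) 0ℤ (-lineSum≤0 ℓ a k)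
lineSumFace ℓ a k (inj₂ _) = integerFace (lineWeights ℓ a k) 1ℤ (lineSum≤1 ℓ a k)

vert-lineSumFace⁺ : ∀ {n} ℓ a k {v} (bitV : Bit v) {Z : Mat n} → IsASM Z → lineSum ℓ a k Z ≡ v →
  vert (lineSumFace ℓ a k bitV) Z
vert-lineSumFace⁺ ℓ a k (inj₁ refl) {Z} asm ≡0 =
  vert-integerFace⁺ (-lineWeights ℓ a k) 0ℤ (-lineSum≤0 ℓ a k) asm (trans (⟨-lineWeights⟩ ℓ a k Z) (cong -_ ≡0))
vert-lineSumFace⁺ ℓ a k (inj₂ refl) {Z} asm ≡1 =
  vert-integerFace⁺ (lineWeights ℓ a k) 1ℤ (lineSum≤1 ℓ a k) asm (trans (⟨lineWeights⟩ ℓ a k Z) ≡1)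

vert-lineSumFace⁻ : ∀ {n} ℓ a k {v} (bitV : Bit v) {Z : Mat n} → vert (lineSumFace ℓ a k bitV) Z →
  lineSum ℓ a k Z ≡ v
vert-lineSumFace⁻ ℓ a k (inj₁ refl) {Z} on =
  trans (sym (ℤP.neg-involutive _))
        (cong -_ (trans (sym (⟨-lineWeights⟩ ℓ a k Z)) (vert-integerFace⁻ (-lineWeights ℓ a k) 0ℤ (-lineSum≤0 ℓ a k) on)))
vert-lineSumFace⁻ ℓ a k (inj₂ refl) {Z} on =
  trans (sym (⟨lineWeights⟩ ℓ a k Z)) (vert-integerFace⁻ (lineWeights ℓ a k) 1ℤ (lineSum≤1 ℓ a k) on)

Tight : ∀ {n} → Line → Fin n → ℕ → Mat n → List (Mat n) → Set
Tight ℓ a k Y L = All (λ W → lineSum ℓ a k W ≡ lineSum ℓ a k Y) L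

tight? : ∀ {n} ℓ (a : Fin n) k Y L → Dec (Tight ℓ a k Y L)
tight? ℓ a k Y = all? λ W → lineSum ℓ a k W ℤP.≟ lineSum ℓ a k Y

-- ASM_n is cut out by the inequalities 0 ≤ lineSum ℓ a k ≤ 1, so this is the smallest face containing Y and L.
module TightFace {n} {Y : Mat n} (asmY : IsASM Y) (L : List (Mat n)) where

  constraintFace : Line → Fin n → Fin n → Face (IsASM {n})
  constraintFace ℓ a k =
    faceWhen (tight? ℓ a (toℕ k) Y L) (lineSumFace ℓ a (toℕ k) (lineSum-bit asmY ℓ a (toℕ k)))

  lineFaces : Fin n → Fin n → Face (IsASM {n})
  lineFaces a k = constraintFace row a k ∩ᶠ constraintFace col a k

  tightFace : Face (IsASM {n})
  tightFace = ⋂ᶠ λ a → ⋂ᶠ (lineFaces a)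

  vert-tightFace⁺ : ∀ {Z} → IsASM Z → (∀ ℓ a k → Tight ℓ a k Y L → lineSum ℓ a k Z ≡ lineSum ℓ a k Y) →
    vert tightFace Z
  vert-tightFace⁺ asmZ agree =
    vert-⋂⁺ (λ a → ⋂ᶠ (lineFaces a)) asmZ λ a → vert-⋂⁺ (lineFaces a) asmZ λ k →
      vert-∩⁺ (constraintFace row a k) (constraintFace col a k) (on row a k) (on col a k)
    where
    on : ∀ ℓ a k → vert (constraintFace ℓ a k) _
    on ℓ a k = vert-faceWhen⁺ (tight? ℓ a (toℕ k) Y L) _ asmZ λ tight →
      vert-lineSumFace⁺ ℓ a (toℕ k) (lineSum-bit asmY ℓ a (toℕ k)) asmZ (agree ℓ a (toℕ k) tight)

  vert-tightFace⁻ : ∀ {Z} → vert tightFace Z → ∀ ℓ a k → Tight ℓ a k Y L → lineSum ℓ a k Z ≡ lineSum ℓ a k Y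
  vert-tightFace⁻ {Z} on ℓ a k tight with k ℕP.<? n
  ... | no  k≮n = trans (lineSum-≥ ℓ a Z (ℕP.≮⇒≥ k≮n)) (sym (lineSum-≥ ℓ a Y (ℕP.≮⇒≥ k≮n)))
  ... | yes k<n = subst (λ k → lineSum ℓ a k Z ≡ lineSum ℓ a k Y) (FinP.toℕ-fromℕ< k<n) agree
    where
    k′ = fromℕ< k<n
    onLines : vert (lineFaces a k′) Z
    onLines = vert-⋂⁻ (lineFaces a) (vert-⋂⁻ (λ a → ⋂ᶠ (lineFaces a)) on a) k′
    onConstraint : ∀ ℓ′ → vert (constraintFace ℓ′ a k′) Z
    onConstraint row = proj₁ (vert-∩⁻ (constraintFace row a k′) (constraintFace col a k′) onLines)
    onConstraint col = proj₂ (vert-∩⁻ (constraintFace row a k′) (constraintFace col a k′) onLines)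
    agree : lineSum ℓ a (toℕ k′) Z ≡ lineSum ℓ a (toℕ k′) Y
    agree = vert-lineSumFace⁻ ℓ a (toℕ k′) (lineSum-bit asmY ℓ a (toℕ k′))
      (vert-faceWhen⁻ (tight? ℓ a (toℕ k′) Y L) _ (onConstraint ℓ)
        (subst (λ k → Tight ℓ a k Y L) (sym (FinP.toℕ-fromℕ< k<n)) tight))

-- S₃ as the dihedral group of the triangle: (false , c) is i ↦ i + c, (true , c) is i ↦ c − i (mod 3).
S₃ : Set
S₃ = Bool × Fin 3

image : S₃ → Fin 3 → Fin 3
image (false , c) i = (toℕ i ℕ.+ toℕ c) mod 3
image (true  , c) i = (3 ℕ.+ toℕ c ℕ.∸ toℕ i) mod 3

_≟ₛ_ : (σ τ : S₃) → Dec (σ ≡ τ)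
_≟ₛ_ = ProductP.≡-dec BoolP._≟_ FinP._≟_

all-S₃? : ∀ {P : S₃ → Set} → (∀ σ → Dec (P σ)) → Dec (∀ σ → P σ)
all-S₃? P? = map′ (λ (ps , qs) → λ { (false , c) → ps c ; (true , c) → qs c })
                  (λ all → (λ c → all (false , c)) , (λ c → all (true , c)))
                  (FinP.all? (P? ∘ (false ,_)) ×-dec FinP.all? (P? ∘ (true ,_)))

any-S₃? : ∀ {P : S₃ → Set} → (∀ σ → Dec (P σ)) → Dec (Σ S₃ P)
any-S₃? P? = map′ (λ { (inj₁ (c , p)) → (false , c) , p ; (inj₂ (c , p)) → (true , c) , p })
                  (λ { ((false , c) , p) → inj₁ (c , p) ; ((true , c) , p) → inj₂ (c , p) })
                  (FinP.any? (P? ∘ (false ,_)) ⊎-dec FinP.any? (P? ∘ (true ,_)))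

allS₃ : List S₃
allS₃ = cartesianProduct (false ∷ true ∷ []) (allFin 3)

∈-allS₃ : ∀ σ → σ ∈ allS₃
∈-allS₃ (false , c) = ∈-cartesianProduct⁺ {xs = false ∷ true ∷ []} (here refl) (∈-allFin c)
∈-allS₃ (true  , c) = ∈-cartesianProduct⁺ {xs = false ∷ true ∷ []} (there (here refl)) (∈-allFin c)

avoid : ∀ (σ : S₃) b → Σ (Fin 3) λ c → (b , c) ≢ σ
avoid σ b with (b , zero) ≟ₛ σ
... | no  b0≢σ = zero , b0≢σ
... | yes refl = suc zero , λ ()

¬¬-∀-S₃ : ∀ {P : S₃ → Set} → (∀ σ → ¬ ¬ P σ) → ¬ ¬ (∀ σ → P σ)
¬¬-∀-S₃ ¬¬P ¬∀P =
  ¬¬-∀-Fin (¬¬P ∘ (false ,_)) λ P₀ → ¬¬-∀-Fin (¬¬P ∘ (true ,_)) λ P₁ →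
    ¬∀P λ { (false , c) → P₀ c ; (true , c) → P₁ c }

_≐?_ : ∀ {n} (A B : Mat n) → Dec (A ≐ B)
A ≐? B = FinP.all? λ i → FinP.all? λ j → A i j ℤP.≟ B i j

perm : S₃ → Mat 3
perm σ i j = δ (image σ i) j

δ-bit : ∀ {n} (a b : Fin n) → Bit (δ a b)
δ-bit zero    zero    = inj₂ refl
δ-bit zero    (suc b) = inj₁ refl
δ-bit (suc a) zero    = inj₁ refl
δ-bit (suc a) (suc b) = δ-bit a b

perm-rowSum : ∀ σ i → Σℤ (perm σ i) ≡ 1ℤ
perm-rowSum = from-yes (all-S₃? λ σ → FinP.all? λ i → Σℤ (perm σ i) ℤP.≟ 1ℤ)

perm-colSum : ∀ σ j → Σℤ (λ i → perm σ i j) ≡ 1ℤ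
perm-colSum = from-yes (all-S₃? λ σ → FinP.all? λ j → Σℤ (λ i → perm σ i j) ℤP.≟ 1ℤ)

perm-isPerm : ∀ σ → IsPerm (perm σ)
perm-isPerm σ = record
  { entries = λ i → δ-bit (image σ i) ; rowSum = perm-rowSum σ ; colSum = perm-colSum σ }

vert? : (K : Face B3) → ∀ σ → Dec (vert K (perm σ))
vert? K σ with dot (Face.c K) (perm σ) ℚP.≟ Face.b K
... | yes on = yes (perm-isPerm σ , on)
... | no ¬on = no (¬on ∘ proj₂)

perm-injective : ∀ {σ τ} → perm σ ≐ perm τ → σ ≡ τ
perm-injective {σ} {τ} = from-yes (all-S₃? λ σ → all-S₃? λ τ → (perm σ ≐? perm τ) →-dec (σ ≟ₛ τ)) σ τ

row-δ : ∀ (r : Fin 3 → ℤ) → (∀ j → Bit (r j)) → Σℤ r ≡ 1ℤ → Σ (Fin 3) λ c → ∀ j → r j ≡ δ c j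
row-δ r bits total with shape (bits zero) (bits (suc zero)) (bits (suc (suc zero))) total
  where
  shape : ∀ {x y z} → Bit x → Bit y → Bit z → x + (y + (z + 0ℤ)) ≡ 1ℤ →
    Σ (Fin 3) λ c → x ≡ δ c zero × y ≡ δ c (suc zero) × z ≡ δ c (suc (suc zero))
  shape (inj₂ refl) (inj₁ refl) (inj₁ refl) _ = zero , refl , refl , refl
  shape (inj₁ refl) (inj₂ refl) (inj₁ refl) _ = suc zero , refl , refl , refl
  shape (inj₁ refl) (inj₁ refl) (inj₂ refl) _ = suc (suc zero) , refl , refl , refl
  shape (inj₁ refl) (inj₁ refl) (inj₁ refl) ()
  shape (inj₂ refl) (inj₂ refl) (inj₁ refl) ()
  shape (inj₂ refl) (inj₁ refl) (inj₂ refl) ()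
  shape (inj₁ refl) (inj₂ refl) (inj₂ refl) ()
  shape (inj₂ refl) (inj₂ refl) (inj₂ refl) ()
... | c , r₀ , r₁ , r₂ = c , λ { zero → r₀ ; (suc zero) → r₁ ; (suc (suc zero)) → r₂ }

images-S₃ : ∀ c₀ c₁ c₂ → (∀ j → δ c₀ j + (δ c₁ j + (δ c₂ j + 0ℤ)) ≡ 1ℤ) →
  Σ S₃ λ σ → image σ zero ≡ c₀ × image σ (suc zero) ≡ c₁ × image σ (suc (suc zero)) ≡ c₂
images-S₃ = from-yes (FinP.all? λ c₀ → FinP.all? λ c₁ → FinP.all? λ c₂ →
  (FinP.all? λ j → δ c₀ j + (δ c₁ j + (δ c₂ j + 0ℤ)) ℤP.≟ 1ℤ) →-dec
  any-S₃? λ σ → (image σ zero FinP.≟ c₀) ×-dec (image σ (suc zero) FinP.≟ c₁) ×-dec (image σ (suc (suc zero)) FinP.≟ c₂))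

isPerm⇒perm : ∀ {A : Mat 3} → IsPerm A → Σ S₃ λ σ → A ≐ perm σ
isPerm⇒perm {A} isPerm with row-δ (A zero) (entries zero) (rowSum zero)
                         | row-δ (A (suc zero)) (entries (suc zero)) (rowSum (suc zero))
                         | row-δ (A (suc (suc zero))) (entries (suc (suc zero))) (rowSum (suc (suc zero)))
  where open IsPerm isPerm
... | c₀ , A₀ | c₁ , A₁ | c₂ , A₂ with images-S₃ c₀ c₁ c₂ (λ j →
      trans (sym (cong₂ _+_ (A₀ j) (cong₂ _+_ (A₁ j) (cong (_+ 0ℤ) (A₂ j))))) (IsPerm.colSum isPerm j))
... | σ , refl , refl , refl = σ , λ
  { zero             → A₀
  ; (suc zero)       → A₁
  ; (suc (suc zero)) → A₂ }

⟨⟩ℤ-cong : ∀ {n} (w : Mat n) {A B : Mat n} → A ≐ B → ⟨ w , A ⟩ℤ ≡ ⟨ w , B ⟩ℤ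
⟨⟩ℤ-cong {n} w A≐B = ℤSum.∑-cong {n} λ i → ℤSum.∑-cong {n} λ j → cong (w i j *_) (A≐B i j)

-- ⟨ perm σ + perm τ , perm ρ ⟩ counts the positions where ρ agrees with σ plus those where it agrees with τ.
agreement : S₃ → S₃ → S₃ → ℤ
agreement σ τ ρ = ⟨ perm σ +ᴹ perm τ , perm ρ ⟩ℤ

agreement-≤ : ∀ σ τ ρ → agreement σ τ ρ ≤ agreement σ τ σ
agreement-≤ = from-yes (all-S₃? λ σ → all-S₃? λ τ → all-S₃? λ ρ → agreement σ τ ρ ℤP.≤? agreement σ τ σ)

agreement-sym : ∀ σ τ → agreement σ τ τ ≡ agreement σ τ σ
agreement-sym = from-yes (all-S₃? λ σ → all-S₃? λ τ → agreement σ τ τ ℤP.≟ agreement σ τ σ)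

agreement-maximal : ∀ σ τ ρ → agreement σ τ ρ ≡ agreement σ τ σ → ρ ≡ σ ⊎ ρ ≡ τ
agreement-maximal = from-yes (all-S₃? λ σ → all-S₃? λ τ → all-S₃? λ ρ →
  (agreement σ τ ρ ℤP.≟ agreement σ τ σ) →-dec ((ρ ≟ₛ σ) ⊎-dec (ρ ≟ₛ τ)))

agreement-bound : ∀ σ τ A → B3 A → ⟨ perm σ +ᴹ perm τ , A ⟩ℤ ≤ agreement σ τ σ
agreement-bound σ τ A isPerm with isPerm⇒perm isPerm
... | ρ , A≐ρ = ℤP.≤-trans (ℤP.≤-reflexive (⟨⟩ℤ-cong (perm σ +ᴹ perm τ) A≐ρ)) (agreement-≤ σ τ ρ)

-- Every two vertices of B₃ span an edge (or, for σ = τ, a vertex).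
pairFace : S₃ → S₃ → Face B3
pairFace σ τ = integerFace (perm σ +ᴹ perm τ) (agreement σ τ σ) (agreement-bound σ τ)

vert-pairFace⁻ : ∀ σ τ {A} → vert (pairFace σ τ) A → A ≐ perm σ ⊎ A ≐ perm τ
vert-pairFace⁻ σ τ {A} on with isPerm⇒perm (proj₁ on)
... | ρ , A≐ρ = Sum.map (λ ρ≡σ → subst (λ π → A ≐ perm π) ρ≡σ A≐ρ) (λ ρ≡τ → subst (λ π → A ≐ perm π) ρ≡τ A≐ρ)
  (agreement-maximal σ τ ρ (trans (sym (⟨⟩ℤ-cong (perm σ +ᴹ perm τ) A≐ρ))
    (vert-integerFace⁻ (perm σ +ᴹ perm τ) (agreement σ τ σ) (agreement-bound σ τ) on)))

vert-pairFace-self⁻ : ∀ σ {A} → vert (pairFace σ σ) A → A ≐ perm σ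
vert-pairFace-self⁻ σ on = [ (λ A≐σ → A≐σ) , (λ A≐σ → A≐σ) ]′ (vert-pairFace⁻ σ σ on)

vert-pairFaceˡ : ∀ σ τ → vert (pairFace σ τ) (perm σ)
vert-pairFaceˡ σ τ = vert-integerFace⁺ (perm σ +ᴹ perm τ) (agreement σ τ σ) (agreement-bound σ τ) (perm-isPerm σ) refl

vert-pairFaceʳ : ∀ σ τ → vert (pairFace σ τ) (perm τ)
vert-pairFaceʳ σ τ = vert-integerFace⁺ (perm σ +ᴹ perm τ) (agreement σ τ σ) (agreement-bound σ τ) (perm-isPerm τ) (agreement-sym σ τ)

parity-balance : ∀ s → ∑ᴹ (λ c → perm (s , c)) ≐ ∑ᴹ (λ c → perm (not s , c))
parity-balance false = from-yes (∑ᴹ (λ c → perm (false , c)) ≐? ∑ᴹ (λ c → perm (true , c)))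
parity-balance true  = from-yes (∑ᴹ (λ c → perm (true , c)) ≐? ∑ᴹ (λ c → perm (false , c)))

B3-parity-closed : ∀ (K : Face B3) s → (∀ c → vert K (perm (s , c))) → ∀ c → vert K (perm (not s , c))
B3-parity-closed K s = face-balanced K (λ c → perm (s , c)) (λ c → perm (not s , c)) (parity-balance s) (λ c → perm-isPerm (not s , c))

record B3Shape {n} (F : Face (IsASM {n})) : Set where
  field
    X             : S₃ → Mat n
    X-vert        : ∀ σ → vert F (X σ)
    vert-X        : ∀ {Y} → vert F Y → Σ S₃ λ σ → Y ≐ X σ
    X-injective   : ∀ {σ τ} → X σ ≐ X τ → σ ≡ τ
    edge          : S₃ → S₃ → Face (IsASM {n})
    X-edgeˡ       : ∀ σ τ → vert (edge σ τ) (X σ)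
    X-edgeʳ       : ∀ σ τ → vert (edge σ τ) (X τ)
    edge-X        : ∀ σ τ {Y} → vert (edge σ τ) Y → Y ≐ X σ ⊎ Y ≐ X τ
    parity-closed : ∀ G → G ⊑ F → ∀ s → (∀ c → vert G (X (s , c))) → ∀ c → vert G (X (not s , c))

InBox : ℕ → ℕ × ℕ → Set
InBox n (a , b) = a ℕ.≤ n × b ℕ.≤ n

box-outer : ∀ {n} ℓ (a : Fin n) {k} → k ℕ.≤ n → InBox n (outer ℓ a k)
box-outer row a k≤n = ℕP.<⇒≤ (FinP.toℕ<n a) , k≤n
box-outer col a k≤n = k≤n , ℕP.<⇒≤ (FinP.toℕ<n a)

box-inner : ∀ {n} ℓ (a : Fin n) {k} → k ℕ.≤ n → InBox n (inner ℓ a k)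
box-inner row a k≤n = FinP.toℕ<n a , k≤n
box-inner col a k≤n = k≤n , FinP.toℕ<n a

module HeightOrder {n} {F : Face (IsASM {n})} (shape : B3Shape F) where
  open B3Shape shape

  X-isASM : ∀ σ → IsASM (X σ)
  X-isASM σ = proj₁ (X-vert σ)

  h : S₃ → ℕ × ℕ → ℤ
  h σ = heightAt (X σ)

  infix 4 _≼_

  _≼_ : S₃ → S₃ → Set
  σ ≼ τ = ∀ {p} → InBox n p → h σ p ≤ h τ p

  h-injective : ∀ {σ τ} → (∀ {p} → InBox n p → h σ p ≡ h τ p) → σ ≡ τ
  h-injective {σ} {τ} same = X-injective λ i j →
    trans (sym (fromHeight-height (X σ) i j))
      (trans (fromHeight-cong (λ a≤n b≤n → same (a≤n , b≤n)) i j) (fromHeight-height (X τ) i j))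

  edge-combination : ∀ {_∙_ _∘_} → HeightOperation _∙_ → HeightOperation _∘_ →
    (∀ x y → (x ∙ y) + (x ∘ y) ≡ x + y) → ∀ σ τ →
    (∀ {p} → InBox n p → h σ p ∙ h τ p ≡ h σ p) ⊎ (∀ {p} → InBox n p → h σ p ∙ h τ p ≡ h τ p)
  edge-combination {_∙_} {_∘_} op op′ sum σ τ =
    Sum.map agrees agrees (edge-X σ τ (face-extreme (edge σ τ) (fromHeight-isASM isH) (fromHeight-isASM isH′)
      (fromHeight-splits (X σ) (X τ) g g′ (λ a b → sum _ _)) (X-edgeˡ σ τ) (X-edgeʳ σ τ)))
    where
    g g′ : ℕ → ℕ → ℤ
    g  a b = height (X σ) a b ∙ height (X τ) a b
    g′ a b = height (X σ) a b ∘ height (X τ) a b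
    isH  = isHeight-∙ op  (height-isHeight (X-isASM σ)) (height-isHeight (X-isASM τ))
    isH′ = isHeight-∙ op′ (height-isHeight (X-isASM σ)) (height-isHeight (X-isASM τ))
    agrees : ∀ {ρ} → fromHeight g ≐ X ρ → ∀ {p} → InBox n p → g (proj₁ p) (proj₂ p) ≡ h ρ p
    agrees {ρ} g≐ρ {a , b} (a≤n , b≤n) = trans (sym (height-fromHeight isH a≤n b≤n)) (height-cong g≐ρ a b)

  ≼-total : ∀ σ τ → σ ≼ τ ⊎ τ ≼ σ
  ≼-total σ τ = Sum.map (λ min≡σ box → ℤP.i⊓j≡i⇒i≤j (min≡σ box)) (λ min≡τ box → ℤP.i⊓j≡j⇒j≤i (min≡τ box))
    (edge-combination ⊓-heightOperation ⊔-heightOperation ⊓-+-⊔ σ τ)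

  ≼-near : ∀ σ τ {p} → InBox n p → h τ p ≤ sucℤ (h σ p)
  ≼-near σ τ {p} box with edge-combination suc-⊓-heightOperation ⊔-pred-heightOperation suc-⊓-+-⊔-pred σ τ
  ... | inj₂ min≡τ = ℤP.i⊓j≡j⇒j≤i (min≡τ box)
  ... | inj₁ min≡σ with ℤP.≤-total (h τ p) (sucℤ (h σ p))
  ...   | inj₁ τ≤1+σ = τ≤1+σ
  ...   | inj₂ 1+σ≤τ = ⊥-elim (ℤP.i≢suc[i] (trans (sym (min≡σ box)) (ℤP.i≤j⇒i⊓j≡i 1+σ≤τ)))

  ≼-antisym : ∀ {σ τ} → σ ≼ τ → τ ≼ σ → σ ≡ τ
  ≼-antisym σ≼τ τ≼σ = h-injective λ box → ℤP.≤-antisym (σ≼τ box) (τ≼σ box)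

  ≼-isTotalOrder : IsTotalOrder _≡_ _≼_
  ≼-isTotalOrder = record
    { isPartialOrder = record
      { isPreorder = record
        { isEquivalence = isEquivalence
        ; reflexive     = λ { refl box → ℤP.≤-refl }
        ; trans         = λ σ≼τ τ≼ρ box → ℤP.≤-trans (σ≼τ box) (τ≼ρ box) }
      ; antisym = ≼-antisym }
    ; total = ≼-total }

  _≼?_ : ∀ σ τ → Dec (σ ≼ τ)
  σ ≼? τ with ≼-total σ τ | σ ≟ₛ τ
  ... | inj₁ σ≼τ | _      = yes σ≼τ
  ... | inj₂ τ≼σ | yes σ≡τ = yes (subst (σ ≼_) σ≡τ λ box → ℤP.≤-refl)
  ... | inj₂ τ≼σ | no σ≢τ  = no λ σ≼τ → σ≢τ (≼-antisym σ≼τ τ≼σ)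

  ≼-isDecTotalOrder : IsDecTotalOrder _≡_ _≼_
  ≼-isDecTotalOrder = record { isTotalOrder = ≼-isTotalOrder ; _≟_ = _≟ₛ_ ; _≤?_ = _≼?_ }

module NoB3Shape {n} {F : Face (IsASM {n})} (shape : B3Shape F) where
  open B3Shape shape
  open HeightOrder shape
  open ListOrder ≼-isDecTotalOrder

  module Extremes (lowest : S₃) (lowest-≼ : ∀ σ → lowest ≼ σ) (highest : S₃) (≼-highest : ∀ σ → σ ≼ highest) where

    s : Bool
    s = proj₁ lowest

    class : List S₃
    class = map (s ,_) (allFin 3)

    ∈-class : ∀ c → (s , c) ∈ class
    ∈-class c = ∈-map⁺ (s ,_) (∈-allFin c)

    T : List S₃
    T = highest ∷ class

    m : S₃
    m = not s , proj₁ (avoid highest (not s))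

    m∉T : m ∉ T
    m∉T (here m≡highest) = proj₂ (avoid highest (not s)) m≡highest
    m∉T (there m∈class) with ∈-map⁻ (s ,_) m∈class
    ... | c , _ , m≡sc = BoolP.not-¬ refl (sym (cong proj₁ m≡sc))

    L : List (Mat n)
    L = map X class

    module TF = TightFace (X-isASM highest) L

    G : Face (IsASM {n})
    G = F ∩ᶠ TF.tightFace

    G⊑F : G ⊑ F
    G⊑F A on = proj₁ (vert-∩⁻ F TF.tightFace on)

    X-vert-G : ∀ {t} → t ∈ T → vert G (X t)
    X-vert-G {t} t∈T = vert-∩⁺ F TF.tightFace (X-vert t) (TF.vert-tightFace⁺ (X-isASM t) (agree t∈T))
      where
      agree : t ∈ T → ∀ ℓ a k → Tight ℓ a k (X highest) L → lineSum ℓ a k (X t) ≡ lineSum ℓ a k (X highest)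
      agree (here refl)     ℓ a k _     = refl
      agree (there t∈class) ℓ a k tight = All.lookup (AllP.map⁻ {f = X} tight) t∈class

    -- G is the smallest face containing the vertices in T, and by parity it contains m as well.
    m-tight : ∀ ℓ a k → Tight ℓ a k (X highest) L → lineSum ℓ a k (X m) ≡ lineSum ℓ a k (X highest)
    m-tight = TF.vert-tightFace⁻ (proj₂ (vert-∩⁻ F TF.tightFace m-vert-G))
      where
      m-vert-G : vert G (X m)
      m-vert-G = parity-closed G G⊑F s (λ c → X-vert-G (there (∈-class c))) _

    module Between (i j : S₃) (i∈T : i ∈ T) (i≼m : i ≼ m) (j∈T : j ∈ T) (m≼j : m ≼ j)
                   (consecutive : ∀ {t} → t ∈ T → t ≼ i ⊎ j ≼ t) where

      V : Mat n
      V = X i +ᴹ X j -ᴹ X m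

      V-lineSum-bit : ∀ ℓ a {k} → k ℕ.≤ n →
        Bit (lineSum ℓ a k (X i) + lineSum ℓ a k (X j) - lineSum ℓ a k (X m))
      V-lineSum-bit ℓ a {k} k≤n with bits-combination (bit i) (bit j) (bit m)
        where bit = λ t → lineSum-bit (X-isASM t) ℓ a k
      ... | inj₁ b = b
      -- Otherwise j is one step above i at both ends of the line, so every vertex of T, hence m, has the
      -- line sum of i.
      ... | inj₂ (vᵢ≡vⱼ , vₘ≢vᵢ) = ⊥-elim (vₘ≢vᵢ (trans (m-tight ℓ a k tight) (v≡vᵢ (here refl))))
        where
        p = outer ℓ a k
        q = inner ℓ a k
        P = box-outer ℓ a k≤n
        Q = box-inner ℓ a k≤n
        v≡ : ∀ t → lineSum ℓ a k (X t) ≡ h t p - h t q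
        v≡ t = lineSum-height ℓ a k (X t)
        steps : h j p ≡ sucℤ (h i p) × h j q ≡ sucℤ (h i q)
        steps = both-step-up (i≼m P) (m≼j P) (≼-near i j P) (i≼m Q) (m≼j Q) (≼-near i j Q)
          (trans (sym (v≡ i)) (trans vᵢ≡vⱼ (v≡ j))) (λ e → vₘ≢vᵢ (trans (v≡ m) (trans e (sym (v≡ i)))))
        v≡vᵢ : ∀ {t} → t ∈ T → lineSum ℓ a k (X t) ≡ lineSum ℓ a k (X i)
        v≡vᵢ {t} t∈T = trans (v≡ t) (trans (pinned (proj₁ steps) (proj₂ steps) (Sum.map
          (λ t≼i → t≼i P , t≼i Q , ≼-near t j P , ≼-near t j Q)
          (λ j≼t → j≼t P , j≼t Q , ≼-near i t P , ≼-near i t Q)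
          (consecutive t∈T))) (sym (v≡ i)))
        tight : Tight ℓ a k (X highest) L
        tight = AllP.map⁺ (All.tabulate λ t∈class → trans (v≡vᵢ (there t∈class)) (sym (v≡vᵢ (here refl))))

      V-isASM : IsASM V
      V-isASM = bitPartialSums⇒asm record
        { rowBit   = lineBit row
        ; colBit   = lineBit col
        ; rowTotal = λ a → trans (sym (sumFrom-0 (V a))) (total row a)
        ; colTotal = λ a → trans (sym (sumFrom-0 (λ b → V b a))) (total col a) }
        where
        lineBit : ∀ ℓ a k → Bit (lineSum ℓ a k V)
        lineBit ℓ a k with k ℕP.≤? n
        ... | yes k≤n = subst Bit (sym (lineSum-+- (X i) (X j) (X m) ℓ a k)) (V-lineSum-bit ℓ a k≤n)
        ... | no  k≰n = inj₁ (lineSum-≥ ℓ a V (ℕP.<⇒≤ (ℕP.≰⇒> k≰n)))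
        total : ∀ ℓ a → lineSum ℓ a 0 V ≡ 1ℤ
        total ℓ a = trans (lineSum-+- (X i) (X j) (X m) ℓ a 0)
          (cong₂ _-_ (cong₂ _+_ (lineSum-total (X-isASM i) ℓ a) (lineSum-total (X-isASM j) ℓ a))
                     (lineSum-total (X-isASM m) ℓ a))

      V-vert : vert F V
      V-vert = face-extreme F V-isASM (X-isASM m) (λ a b → cancel (X i a b) (X j a b) (X m a b)) (X-vert i) (X-vert j)
        where
        cancel : ∀ x y z → x + y - z + z ≡ x + y
        cancel = solve-∀

      reflection-impossible : ∀ r → (∀ {p} → InBox n p → h r p ≡ h i p + h j p - h m p) → ⊥
      reflection-impossible r h-r = [ r≼m⇒⊥ , m≼r⇒⊥ ]′ (≼-total r m)
        where
        r≼m⇒⊥ : r ≼ m → ⊥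
        r≼m⇒⊥ r≼m = m∉T (subst (_∈ T) (≼-antisym j≼m m≼j) j∈T)
          where
          j≼m : j ≼ m
          j≼m box = reflection-below (i≼m box) (m≼j box) (≼-near i j box)
            (ℤP.≤-trans (ℤP.≤-reflexive (sym (h-r box))) (r≼m box))
        m≼r⇒⊥ : m ≼ r → ⊥
        m≼r⇒⊥ m≼r = m∉T (subst (_∈ T) (≼-antisym i≼m m≼i) i∈T)
          where
          m≼i : m ≼ i
          m≼i box = reflection-above (i≼m box) (m≼j box) (≼-near i j box)
            (ℤP.≤-trans (m≼r box) (ℤP.≤-reflexive (h-r box)))

      impossible : ⊥
      impossible with vert-X V-vert
      ... | r , V≐r = reflection-impossible r λ { {a , b} _ →
        trans (height-cong (≐-sym V≐r) a b) (height-+- (X i) (X j) (X m) a b) }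

    impossible : ⊥
    impossible =
      let i , j , (i∈T , i≼m) , (j∈T , m≼j) , consecutive =
            neighbours m T (there (∈-class (proj₂ lowest))) (lowest-≼ m) (here refl) (≼-highest m)
      in Between.impossible i j i∈T i≼m j∈T m≼j consecutive

  impossible : ⊥
  impossible =
    let lowest , lowest-≼ = least (false , zero) ∈-allS₃
        highest , ≼-highest = greatest (false , zero) ∈-allS₃
    in Extremes.impossible lowest lowest-≼ highest ≼-highest

no-B3Shape : ∀ {n} {F : Face (IsASM {n})} → ¬ B3Shape F
no-B3Shape shape = NoB3Shape.impossible shape

module FromLatticeIso {n} {F : Face (IsASM {n})} (iso : FaceLatticeIsoB3 F) where

  φ : FacesBelow F → Face B3
  φ = proj₁ iso

  face : FacesBelow F → Face (IsASM {n})
  face = proj₁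

  φ-mono : ∀ G H → face G ⊑ face H → φ G ⊑ φ H
  φ-mono G H = Equivalence.to (proj₁ (proj₂ iso) G H)

  φ-reflects : ∀ G H → φ G ⊑ φ H → face G ⊑ face H
  φ-reflects G H = Equivalence.from (proj₁ (proj₂ iso) G H)

  preimage : Face B3 → FacesBelow F
  preimage K = proj₁ (proj₂ (proj₂ iso) K)

  φ-preimage⊑ : ∀ K → φ (preimage K) ⊑ K
  φ-preimage⊑ K = proj₁ (proj₂ (proj₂ (proj₂ iso) K))

  ⊑φ-preimage : ∀ K → K ⊑ φ (preimage K)
  ⊑φ-preimage K = proj₂ (proj₂ (proj₂ (proj₂ iso) K))

  ∅ : FacesBelow F
  ∅ = emptyFace , λ A on → ⊥-elim (¬vert-emptyFace {V = IsASM} on)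

  ¬vert-φ∅ : ∀ {A} → ¬ vert (φ ∅) A
  ¬vert-φ∅ {A} on = ¬vert-emptyFace {V = B3}
    (φ-preimage⊑ emptyFace A (φ-mono ∅ (preimage emptyFace) (λ B on∅ → ⊥-elim (¬vert-emptyFace {V = IsASM} on∅)) A on))

  φ-nonempty : ∀ G {Y} → vert (face G) Y → Σ S₃ λ σ → vert (φ G) (perm σ)
  φ-nonempty G {Y} onY with any-S₃? (vert? (φ G))
  ... | yes found = found
  ... | no ¬found = ⊥-elim (¬vert-emptyFace {V = IsASM} (φ-reflects G ∅ φG⊑φ∅ Y onY))
    where
    φG⊑φ∅ : φ G ⊑ φ ∅
    φG⊑φ∅ A on with isPerm⇒perm (proj₁ on)
    ... | σ , A≐σ = ⊥-elim (¬found (σ , vert-resp-≐ (φ G) (perm-isPerm σ) A≐σ on))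

  E : S₃ → S₃ → FacesBelow F
  E σ τ = preimage (pairFace σ τ)

  perm-vert-φE : ∀ σ τ → vert (φ (E σ τ)) (perm σ) × vert (φ (E σ τ)) (perm τ)
  perm-vert-φE σ τ = ⊑φ-preimage (pairFace σ τ) _ (vert-pairFaceˡ σ τ) , ⊑φ-preimage (pairFace σ τ) _ (vert-pairFaceʳ σ τ)

  φE-perm : ∀ σ τ {ρ} → vert (φ (E σ τ)) (perm ρ) → ρ ≡ σ ⊎ ρ ≡ τ
  φE-perm σ τ on = Sum.map perm-injective perm-injective (vert-pairFace⁻ σ τ (φ-preimage⊑ (pairFace σ τ) _ on))

  E-nonempty : ∀ σ → ¬ ¬ Σ (Mat n) (vert (face (E σ σ)))
  E-nonempty σ empty = ¬vert-φ∅ (φ-mono (E σ σ) ∅ (λ A on → ⊥-elim (empty (A , on))) _ (proj₁ (perm-vert-φE σ σ)))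

  module Vertices (X : S₃ → Mat n) (X-vert-E : ∀ σ → vert (face (E σ σ)) (X σ)) where

    φ⇒vert : ∀ H {σ} → vert (φ H) (perm σ) → vert (face H) (X σ)
    φ⇒vert H {σ} on = φ-reflects (E σ σ) H φEσσ⊑φH (X σ) (X-vert-E σ)
      where
      φEσσ⊑φH : φ (E σ σ) ⊑ φ H
      φEσσ⊑φH A onE = vert-resp-≐ (φ H) (proj₁ onE) (≐-sym (vert-pairFace-self⁻ σ (φ-preimage⊑ (pairFace σ σ) A onE))) on

    singleton : ∀ {Y} → vert F Y → FacesBelow F
    singleton onY = F ∩ᶠ TightFace.tightFace (proj₁ onY) [] , λ A on → proj₁ (vert-∩⁻ F (TightFace.tightFace (proj₁ onY) []) on)

    vert-singleton : ∀ {Y} (onY : vert F Y) → vert (face (singleton onY)) Y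
    vert-singleton onY = vert-∩⁺ F (TightFace.tightFace (proj₁ onY) []) onY (TightFace.vert-tightFace⁺ (proj₁ onY) [] (proj₁ onY) λ _ _ _ _ → refl)

    singleton-only : ∀ {Y} (onY : vert F Y) {Z} → vert (face (singleton onY)) Z → Z ≐ Y
    singleton-only onY onZ = lineSums-determine λ a k →
      TightFace.vert-tightFace⁻ (proj₁ onY) [] (proj₂ (vert-∩⁻ F (TightFace.tightFace (proj₁ onY) []) onZ)) row a k []

    vert-X : ∀ {Y} → vert F Y → Σ S₃ λ σ → Y ≐ X σ
    vert-X onY = proj₁ found , ≐-sym (singleton-only onY (φ⇒vert (singleton onY) (proj₂ found)))
      where
      found = φ-nonempty (singleton onY) (vert-singleton onY)

    E-only : ∀ σ {Y} → vert (face (E σ σ)) Y → Y ≐ X σ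
    E-only σ {Y} onY = ≐-sym (singleton-only onF (φ⇒vert S (subst (λ ρ → vert (φ S) (perm ρ)) ρ≡σ (proj₂ found))))
      where
      onF = proj₂ (E σ σ) Y onY
      S = singleton onF
      found = φ-nonempty S (vert-singleton onF)
      S⊑E : face S ⊑ face (E σ σ)
      S⊑E Z onZ = vert-resp-≐ (face (E σ σ)) (proj₁ onZ) (≐-sym (singleton-only onF onZ)) onY
      ρ≡σ : proj₁ found ≡ σ
      ρ≡σ = perm-injective (vert-pairFace-self⁻ σ (φ-preimage⊑ (pairFace σ σ) _ (φ-mono S (E σ σ) S⊑E _ (proj₂ found))))

    vert⇒φ : ∀ H {σ} → vert (face H) (X σ) → vert (φ H) (perm σ)
    vert⇒φ H {σ} onH = φ-mono (E σ σ) H Eσσ⊑H (perm σ) (proj₁ (perm-vert-φE σ σ))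
      where
      Eσσ⊑H : face (E σ σ) ⊑ face H
      Eσσ⊑H Z onZ = vert-resp-≐ (face H) (proj₁ onZ) (≐-sym (E-only σ onZ)) onH

    X-vert : ∀ σ → vert F (X σ)
    X-vert σ = proj₂ (E σ σ) (X σ) (X-vert-E σ)

    X-injective : ∀ {σ τ} → X σ ≐ X τ → σ ≡ τ
    X-injective {σ} {τ} σ≐τ = [ (λ e → e) , (λ e → e) ]′
      (φE-perm τ τ (vert⇒φ (E τ τ) (vert-resp-≐ (face (E τ τ)) (proj₁ (X-vert σ)) (≐-sym σ≐τ) (X-vert-E τ))))

    edge-X : ∀ σ τ {Y} → vert (face (E σ τ)) Y → Y ≐ X σ ⊎ Y ≐ X τ
    edge-X σ τ {Y} onY = Sum.map (λ ρ≡σ → subst (λ π → Y ≐ X π) ρ≡σ Y≐ρ) (λ ρ≡τ → subst (λ π → Y ≐ X π) ρ≡τ Y≐ρ)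
      (φE-perm σ τ (vert⇒φ (E σ τ) (vert-resp-≐ (face (E σ τ)) (proj₁ (X-vert ρ)) Y≐ρ onY)))
      where
      found = vert-X (proj₂ (E σ τ) Y onY)
      ρ = proj₁ found
      Y≐ρ = proj₂ found

    parity-closed : ∀ G → G ⊑ F → ∀ s → (∀ c → vert G (X (s , c))) → ∀ c → vert G (X (not s , c))
    parity-closed G G⊑F s onG c =
      φ⇒vert (G , G⊑F) (B3-parity-closed (φ (G , G⊑F)) s (λ c → vert⇒φ (G , G⊑F) (onG c)) c)

    shape : B3Shape F
    shape = record
      { X             = X
      ; X-vert        = X-vert
      ; vert-X        = vert-X
      ; X-injective   = X-injective
      ; edge          = λ σ τ → face (E σ τ)
      ; X-edgeˡ       = λ σ τ → φ⇒vert (E σ τ) (proj₁ (perm-vert-φE σ τ))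
      ; X-edgeʳ       = λ σ τ → φ⇒vert (E σ τ) (proj₂ (perm-vert-φE σ τ))
      ; edge-X        = edge-X
      ; parity-closed = parity-closed }

  -- A vertex of each preimage of a vertex of B₃ can only be chosen under ¬¬, which suffices for a negative goal.
  ¬¬shape : ¬ ¬ B3Shape F
  ¬¬shape noShape = ¬¬-∀-S₃ E-nonempty λ vertices →
    noShape (Vertices.shape (proj₁ ∘ vertices) (proj₂ ∘ vertices))

mainTheorem7 : ¬ Σ ℕ (λ n → Σ (Face (IsASM {n})) (λ F → FaceLatticeIsoB3 F))
mainTheorem7 (n , F , iso) = FromLatticeIso.¬¬shape {F = F} iso no-B3Shape
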